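{- Let $n\ge2$ and let $\mathscr A$ be any orientation of $A_{n-1}$. There are triangulations $T,\widetilde T\in\mathcal T_{n+2}$ of the labelled $(n+2)$-gon such that $M_{\mathscr A}(T)=(1,2,\dots,n)$ and $M_{\mathscr A}(\widetilde T)=(n,n-1,\dots,1)$.
   Context: Let $[n]=\{1,\dots,n\}$. $A_{n-1}$ is the path with vertices $\tau_1,\dots,\tau_{n-1}$ and edges $\{\tau_i,\tau_{i+1}\}$; an orientation $\mathscr A$ directs each edge. $i\in\{2,\dots,n-1\}$ is up if $\{\tau_{i-1},\tau_i\}$ is directed from $\tau_i$ to $\tau_{i-1}$, down otherwise; $1,n$ are down. Labelled polygon: in a convex $(n+2)$-gon $P$ label a vertex $0$, then counterclockwise the down elements increasingly, then $n+1$, then the up elements decreasingly. A triangulation $T$ is a set of $n-1$ non-crossing diagonals, viewed as a graph with the boundary edges; $\{a,b\}\in T$ means it is an edge; $\mathcal T_{n+2}$ is the set of triangulations. $\mu_i(j)$ ($i\in[n]$, $0\le j\le n+1$) counts edges of the boundary path from $i$ to $j$ using only labels $\le i$ if $j<i$, only labels $\ge i$ if $j\ge i$. $p^T_\ell(i)=\max\{\mu_i(a):0\le a<i,\{a,i\}\in T\}$, $p^T_r(i)=\max\{\mu_i(b):i<b\le n+1,\{i,b\}\in T\}$, $\omega_i=p^T_\ell(i)p^T_r(i)$, $x_i=\omega_i$ ($i$ down) or $n+1-\omega_i$ ($i$ up); $M_{\mathscr A}(T)=(x_1,\dots,x_n)$. -}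

module Defs where

open import Data.Bool using (Bool; true; false; if_then_else_; not; _∧_; _∨_)
open import Data.Nat using (ℕ; zero; suc; _+_; _*_; _∸_; _≤_; _<_; _≡ᵇ_; _<ᵇ_; _≤ᵇ_; _⊔_)
open import Data.Nat.DivMod using (_%_)
open import Data.Nat.Properties using (_≤?_; _<?_)
open import Data.Fin using (Fin; fromℕ<)
open import Data.List using (List; []; _∷_; _++_; map; foldr; upTo; filterᵇ; reverse; length)
open import Data.Bool.ListAction using (all; any)
open import Data.List.Membership.Propositional using (_∈_)
open import Data.List.Relation.Unary.All using (All)
open import Data.List.Relation.Binary.Pointwise using ()
open import Data.List.Relation.Unary.AllPairs using (AllPairs)
open import Data.Product using (Σ; _×_; _,_; proj₁; proj₂)
open import Relation.Nullary using (¬_; yes; no)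
open import Relation.Binary.PropositionalEquality using (_≡_; _≢_)

-- Orientations of the path A_{n-1} (vertices τ_1 … τ_{n-1}).
-- It has n-2 edges e_k = {τ_{k+1}, τ_{k+2}}, k = 0 … n-3 (indexed by
-- Fin (n ∸ 2)).  o k = true  means e_k is directed from τ_{k+2} to τ_{k+1},
--                 o k = false means e_k is directed from τ_{k+1} to τ_{k+2}.

Orientation : ℕ → Set
Orientation n = Fin (n ∸ 2) → Bool

-- i ∈ {2,…,n-1} is up iff {τ_{i-1},τ_i} = e_{i-2} is directed τ_i → τ_{i-1};
-- every other i (in particular 1 and n) is down.
isUp : (n : ℕ) → Orientation n → ℕ → Bool
isUp n o i with 2 ≤? i | (i ∸ 2) <? (n ∸ 2)
... | yes _ | yes p = o (fromℕ< p)
... | _     | _     = false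

isDown : (n : ℕ) → Orientation n → ℕ → Bool
isDown n o i = not (isUp n o i)

range1 : ℕ → List ℕ
range1 n = map suc (upTo n)

-- The labelled (n+2)-gon: the labels read counterclockwise starting at
-- the vertex labelled 0: 0, down elements increasingly, n+1, up elements
-- decreasingly.  Vertices are identified with positions 0 … n+1
-- (counterclockwise order).

labels : (n : ℕ) → Orientation n → List ℕ
labels n o = 0 ∷ filterᵇ (isDown n o) (range1 n)
               ++ suc n ∷ reverse (filterᵇ (isUp n o) (range1 n))

nth : List ℕ → ℕ → ℕ
nth []       _       = 0
nth (x ∷ xs) zero    = x
nth (x ∷ xs) (suc k) = nth xs k

lab : (n : ℕ) → Orientation n → ℕ → ℕ
lab n o p = nth (labels n o) p

indexOf : List ℕ → ℕ → ℕ
indexOf []       a = 0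
indexOf (x ∷ xs) a = if x ≡ᵇ a then 0 else suc (indexOf xs a)

pos : (n : ℕ) → Orientation n → ℕ → ℕ
pos n o a = indexOf (labels n o) a

-- a diagonal, written with positions p < q, not a side of the polygon
IsDiagonal : ℕ → ℕ × ℕ → Set
IsDiagonal n (p , q) = (2 + p ≤ q) × (q ∸ p ≤ n) × (q < 2 + n)

Cross : ℕ × ℕ → ℕ × ℕ → Set
Cross (p , q) (r , s) = (p < r × r < q × q < s) Data.Sum.⊎ (r < p × p < s × s < q)
  where import Data.Sum

IsTriangulation : ℕ → List (ℕ × ℕ) → Set
IsTriangulation n D =
  (length D ≡ n ∸ 1) × All (IsDiagonal n) D
  × AllPairs (λ d e → d ≢ e × ¬ Cross d e) D

Triangulation : ℕ → Set
Triangulation n = Σ (List (ℕ × ℕ)) (IsTriangulation n)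

_≡ᵖ_ : ℕ × ℕ → ℕ × ℕ → Bool
(a , b) ≡ᵖ (c , d) = (a ≡ᵇ c) ∧ (b ≡ᵇ d)

adjPos : (n : ℕ) → List (ℕ × ℕ) → ℕ → ℕ → Bool
adjPos n D p q =
  (suc p % suc (suc n) ≡ᵇ q) ∨ (suc q % suc (suc n) ≡ᵇ p)
  ∨ any (λ d → (d ≡ᵖ (p , q)) ∨ (d ≡ᵖ (q , p))) D

adjLab : (n : ℕ) → Orientation n → List (ℕ × ℕ) → ℕ → ℕ → Bool
adjLab n o D a b = adjPos n D (pos n o a) (pos n o b)

-- μ_i(j): number of edges of the boundary path from i to j using only
-- labels ≤ i (if j < i) resp. ≥ i (if j ≥ i).  The two boundary paths
-- from i to j are the counterclockwise one (of length d) and the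
-- clockwise one (of length (n+2) - d); μ takes the counterclockwise one
-- if all its vertices are allowed, otherwise the clockwise one.

mu : (n : ℕ) → Orientation n → ℕ → ℕ → ℕ
mu n o i j =
  if all (λ k → allowed (lab n o ((s + k) % N))) (upTo (suc d))
  then d else N ∸ d
  where
  N = suc (suc n)
  s = pos n o i
  t = pos n o j
  d = (t + N ∸ s) % N
  allowed : ℕ → Bool
  allowed c = if j <ᵇ i then c ≤ᵇ i else i ≤ᵇ c

maximum : List ℕ → ℕ
maximum = foldr _⊔_ 0

pl : (n : ℕ) → Orientation n → List (ℕ × ℕ) → ℕ → ℕ
pl n o D i = maximum (map (mu n o i) (filterᵇ (λ a → adjLab n o D a i) (upTo i)))

pr : (n : ℕ) → Orientation n → List (ℕ × ℕ) → ℕ → ℕ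
pr n o D i = maximum (map (mu n o i)
               (filterᵇ (λ b → adjLab n o D i b) (map (λ k → suc i + k) (upTo (suc n ∸ i)))))

omega : (n : ℕ) → Orientation n → List (ℕ × ℕ) → ℕ → ℕ
omega n o D i = pl n o D i * pr n o D i

xcoord : (n : ℕ) → Orientation n → List (ℕ × ℕ) → ℕ → ℕ
xcoord n o D i = if isUp n o i then suc n ∸ omega n o D i else omega n o D i

M : (n : ℕ) → Orientation n → Triangulation n → List ℕ
M n o T = map (xcoord n o (proj₁ T)) (range1 n)

-- T and T̃ consist of one diagonal for each cut K = 1 … n-1: in T it joins the
-- largest up label ≤ K (or 0) to the smallest down label > K, in T̃ the largest
-- down label ≤ K (or 0) to the smallest up label > K; these are pairwise
-- non-crossing.  Sides of the polygon have μ = 1, and on a diagonal μ is read off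
-- from the places of its endpoints, because the labels increase from 0 to n+1
-- along one boundary arc and decrease back along the other.  Hence
-- (p_ℓ(i), p_r(i)) is (i, 1) for i down and (1, n+1-i) for i up in T, with the
-- roles of down and up exchanged in T̃ (the value other than 1 is attained on the
-- diagonal of cut i-1 or i), so x_i = i in T and x_i = n+1-i in T̃.
module Submission where

open import Defs
open import Data.Nat using (ℕ; _≤_)
open import Data.List using (reverse)
open import Data.Product using (Σ; _×_)
open import Relation.Binary.PropositionalEquality using (_≡_)

open import Data.Bool using (Bool; true; false; if_then_else_; not; _∨_; T; T?)
open import Data.Bool.Properties using (∧-zeroʳ; ∨-zeroʳ; T-≡)
open import Data.Bool.ListAction using (all; any)
open import Data.Nat.DivMod using (_%_; m<n⇒m%n≡m; [m+n]%n≡m%n; n%n≡0)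
open import Data.Nat
open import Data.Nat.Properties
open import Data.List using (List; []; _∷_; _++_; map; upTo; applyUpTo; filterᵇ; length; [_])
open import Data.List.Properties
  using (++-assoc; map-++; length-++; upTo-∷ʳ; filter-++; reverse-++; length-reverse; length-applyUpTo;
         map-cong-local; map-∘; map-applyUpTo; map-id)
open import Data.List.Relation.Unary.All using (All; []; _∷_)
open import Data.List.Relation.Unary.Any using (Any; here; there)
import Data.List.Relation.Unary.Any as Any
import Data.List.Relation.Unary.All.Properties as Allₚ
import Data.List.Relation.Unary.Any.Properties as Anyₚ
import Data.List.Relation.Unary.AllPairs.Properties as AllPairsₚ
open import Data.Product using (_,_; proj₁; proj₂)
open import Data.Sum using (_⊎_; inj₁; inj₂; [_,_]′)
open import Data.Empty using (⊥-elim)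
open import Relation.Nullary using (¬_; yes; no)
open import Relation.Binary.PropositionalEquality
  using (refl; sym; trans; cong; cong₂; subst; subst₂; _≢_; module ≡-Reasoning)
open import Function using (_∘_; id)
open import Function.Bundles using (Equivalence)

<ᵇ-true : ∀ {m k} → m < k → (m <ᵇ k) ≡ true
<ᵇ-true {zero}  {suc k} _         = refl
<ᵇ-true {suc m} {suc k} (s≤s m<k) = <ᵇ-true m<k

<ᵇ-false : ∀ {m k} → k ≤ m → (m <ᵇ k) ≡ false
<ᵇ-false {m}     {zero}  _         = refl
<ᵇ-false {suc m} {suc k} (s≤s k≤m) = <ᵇ-false k≤m

≤ᵇ-true : ∀ {m k} → m ≤ k → (m ≤ᵇ k) ≡ true
≤ᵇ-true {zero}  _   = refl
≤ᵇ-true {suc m} m<k = <ᵇ-true m<k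

≤ᵇ-false : ∀ {m k} → k < m → (m ≤ᵇ k) ≡ false
≤ᵇ-false {suc m} (s≤s k≤m) = <ᵇ-false k≤m

<ᵇ-true⇒< : ∀ m k → (m <ᵇ k) ≡ true → m < k
<ᵇ-true⇒< m k e = <ᵇ⇒< m k (subst T (sym e) _)

<ᵇ-false⇒≥ : ∀ m k → (m <ᵇ k) ≡ false → k ≤ m
<ᵇ-false⇒≥ m k e = ≮⇒≥ (λ m<k → subst T e (<⇒<ᵇ m<k))

≡ᵇ-refl : ∀ m → (m ≡ᵇ m) ≡ true
≡ᵇ-refl zero    = refl
≡ᵇ-refl (suc m) = ≡ᵇ-refl m

≡ᵇ-true⇒≡ : ∀ m k → (m ≡ᵇ k) ≡ true → m ≡ k
≡ᵇ-true⇒≡ m k e = ≡ᵇ⇒≡ m k (subst T (sym e) _)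

≢⇒≡ᵇ-false : ∀ {m k} → m ≢ k → (m ≡ᵇ k) ≡ false
≢⇒≡ᵇ-false {m} {k} m≢k with m ≡ᵇ k in e
... | true  = ⊥-elim (m≢k (≡ᵇ-true⇒≡ m k e))
... | false = refl

bool-cases : ∀ (v : Bool) → v ≡ true ⊎ v ≡ false
bool-cases true  = inj₁ refl
bool-cases false = inj₂ refl

all-upTo-true : ∀ (f : ℕ → Bool) m → (∀ k → k < m → f k ≡ true) → all f (upTo m) ≡ true
all-upTo-true f m h = all-true (upTo m) (Allₚ.applyUpTo⁺₁ id m (λ {k} → h k))
  where
  all-true : ∀ xs → All (λ x → f x ≡ true) xs → all f xs ≡ true
  all-true []       []       = refl
  all-true (x ∷ xs) (p ∷ ps) rewrite p = all-true xs ps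

all-upTo-false : ∀ (f : ℕ → Bool) {m} k → k < m → f k ≡ false → all f (upTo m) ≡ false
all-upTo-false f k k<m e = all-false (upTo _) (Anyₚ.applyUpTo⁺ id e k<m)
  where
  all-false : ∀ xs → Any (λ x → f x ≡ false) xs → all f xs ≡ false
  all-false (x ∷ xs) (here p)  rewrite p = refl
  all-false (x ∷ xs) (there p) rewrite all-false xs p = ∧-zeroʳ (f x)

maximum-filter≡ : ∀ (f : ℕ → ℕ) (P : ℕ → Bool) xs {V} →
  All (λ x → P x ≡ true → f x ≤ V) xs → Any (λ x → P x ≡ true × f x ≡ V) xs →
  maximum (map f (filterᵇ P xs)) ≡ V
maximum-filter≡ f P xs {V} bounded attained = ≤-antisym (upper xs bounded) (lower xs attained)
  where
  upper : ∀ xs → All (λ x → P x ≡ true → f x ≤ V) xs → maximum (map f (filterᵇ P xs)) ≤ V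
  upper []       []       = z≤n
  upper (x ∷ xs) (h ∷ hs) with P x in e
  ... | true  = ⊔-lub (h refl) (upper xs hs)
  ... | false = upper xs hs
  lower : ∀ xs → Any (λ x → P x ≡ true × f x ≡ V) xs → V ≤ maximum (map f (filterᵇ P xs))
  lower (x ∷ xs) (here (p , q)) rewrite p | q = m≤m⊔n V _
  lower (x ∷ xs) (there h) with P x
  ... | true  = ≤-trans (lower xs h) (m≤n⊔m (f x) _)
  ... | false = lower xs h

indexOf-head : ∀ x xs → indexOf (x ∷ xs) x ≡ 0
indexOf-head x xs rewrite ≡ᵇ-refl x = refl

indexOf-cons : ∀ y xs x → y ≢ x → indexOf (y ∷ xs) x ≡ suc (indexOf xs x)
indexOf-cons y xs x y≢x rewrite ≢⇒≡ᵇ-false y≢x = refl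

nth-indexOf : ∀ xs x → indexOf xs x < length xs → nth xs (indexOf xs x) ≡ x
nth-indexOf (y ∷ xs) x h with y ≡ᵇ x in e
... | true  = ≡ᵇ-true⇒≡ y x e
... | false = nth-indexOf xs x (s≤s⁻¹ h)

range1-suc : ∀ m → range1 (suc m) ≡ range1 m ++ [ suc m ]
range1-suc m = trans (cong (map suc) (sym (upTo-∷ʳ m))) (map-++ suc (upTo m) [ m ])

map-range1-cong : ∀ {m} {f g : ℕ → ℕ} → (∀ {i} → 1 ≤ i → i ≤ m → f i ≡ g i) →
  map f (range1 m) ≡ map g (range1 m)
map-range1-cong {m} f≗g = map-cong-local (Allₚ.map⁺ (Allₚ.applyUpTo⁺₁ id m (f≗g (s≤s z≤n))))

reverse-range1 : ∀ m → reverse (range1 m) ≡ map (suc m ∸_) (range1 m)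
reverse-range1 zero    = refl
reverse-range1 (suc m) = begin
  reverse (range1 (suc m))                   ≡⟨ cong reverse (range1-suc m) ⟩
  reverse (range1 m ++ [ suc m ])            ≡⟨ reverse-++ (range1 m) [ suc m ] ⟩
  suc m ∷ reverse (range1 m)                 ≡⟨ cong (suc m ∷_) (reverse-range1 m) ⟩
  suc m ∷ map (suc m ∸_) (range1 m)          ≡⟨ cong (suc m ∷_) (map-∘ (range1 m)) ⟩
  suc m ∷ map (suc (suc m) ∸_) (map suc (range1 m))
    ≡⟨ cong (λ xs → suc m ∷ map (suc (suc m) ∸_) xs) (cong (map suc) (map-applyUpTo id suc m)) ⟩
  map (suc (suc m) ∸_) (range1 (suc m))      ∎
  where open ≡-Reasoning

module Count (P : ℕ → Bool) where

  count : ℕ → ℕ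
  count zero    = 0
  count (suc x) = if P (suc x) then suc (count x) else count x

  select : ℕ → List ℕ
  select m = filterᵇ P (range1 m)

  select-suc : ∀ m → select (suc m) ≡ select m ++ filterᵇ P [ suc m ]
  select-suc m = trans (cong (filterᵇ P) (range1-suc m)) (filter-++ (T? ∘ P) (range1 m) [ suc m ])

  count-suc-true : ∀ x → P (suc x) ≡ true → count (suc x) ≡ suc (count x)
  count-suc-true x e rewrite e = refl

  count-suc-false : ∀ x → P (suc x) ≡ false → count (suc x) ≡ count x
  count-suc-false x e rewrite e = refl

  count-suc-≤ : ∀ x → count (suc x) ≤ suc (count x)
  count-suc-≤ x with P (suc x)
  ... | true  = ≤-refl
  ... | false = n≤1+n _

  count-≤-suc : ∀ x → count x ≤ count (suc x)
  count-≤-suc x with P (suc x)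
  ... | true  = n≤1+n _
  ... | false = ≤-refl

  count-mono : ∀ {x y} → x ≤ y → count x ≤ count y
  count-mono {y = zero}  z≤n = ≤-refl
  count-mono {y = suc y} x≤y with m≤n⇒m<n∨m≡n x≤y
  ... | inj₂ refl          = ≤-refl
  ... | inj₁ (s≤s x≤y′) = ≤-trans (count-mono x≤y′) (count-≤-suc y)

  count-≤ : ∀ x → count x ≤ x
  count-≤ zero    = z≤n
  count-≤ (suc x) = ≤-trans (count-suc-≤ x) (s≤s (count-≤ x))

  count-< : ∀ {x y} → P y ≡ true → x < y → count x < count y
  count-< {y = suc y} e (s≤s x≤y) rewrite count-suc-true y e = s≤s (count-mono x≤y)

  count-≤⇒≤ : ∀ {j k} → P j ≡ true → count j ≤ count k → j ≤ k
  count-≤⇒≤ {j} {k} e h with j ≤? k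
  ... | yes j≤k = j≤k
  ... | no  j≰k = ⊥-elim (<⇒≱ (count-< e (≰⇒> j≰k)) h)

  count-<⇒< : ∀ {k j} → count k < count j → k < j
  count-<⇒< {k} {j} h with k <? j
  ... | yes k<j = k<j
  ... | no  k≮j = ⊥-elim (<⇒≱ h (count-mono (≮⇒≥ k≮j)))

  count-onto : ∀ m {c} → 1 ≤ c → c ≤ count m →
    Σ ℕ λ x → 1 ≤ x × x ≤ m × P x ≡ true × count x ≡ c
  count-onto zero    1≤c c≤0 = ⊥-elim (<⇒≱ 1≤c c≤0)
  count-onto (suc m) 1≤c c≤  with P (suc m) in e
  ... | false with count-onto m 1≤c c≤
  ...   | x , 1≤x , x≤m , Px , cx = x , 1≤x , m≤n⇒m≤1+n x≤m , Px , cx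
  count-onto (suc m) 1≤c c≤ | true with m≤n⇒m<n∨m≡n c≤
  ... | inj₂ refl        = suc m , s≤s z≤n , ≤-refl , e , count-suc-true m e
  ... | inj₁ (s≤s c≤m) with count-onto m 1≤c c≤m
  ...   | x , 1≤x , x≤m , Px , cx = x , 1≤x , m≤n⇒m≤1+n x≤m , Px , cx

  length-select : ∀ m → length (select m) ≡ count m
  length-select zero = refl
  length-select (suc m) rewrite select-suc m | length-++ (select m) {filterᵇ P [ suc m ]} | length-select m
    with P (suc m)
  ... | true  = +-comm (count m) 1
  ... | false = +-identityʳ (count m)

  Absent : ℕ → ℕ → Set
  Absent m x = m < x ⊎ P x ≡ false

  absent-≢ : ∀ {m x} → Absent m x → P m ≡ true → m ≢ x
  absent-≢ (inj₁ m<x) _  refl = <-irrefl refl m<x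
  absent-≢ (inj₂ ¬Px) Pm refl with trans (sym Pm) ¬Px
  ... | ()

  absent-pred : ∀ {m x} → Absent (suc m) x → Absent m x
  absent-pred (inj₁ m<x) = inj₁ (<-trans (n<1+n _) m<x)
  absent-pred (inj₂ ¬Px) = inj₂ ¬Px

  indexOf-select-absent : ∀ m ys {x} → Absent m x → indexOf (select m ++ ys) x ≡ count m + indexOf ys x
  indexOf-select-absent zero    ys _ = refl
  indexOf-select-absent (suc m) ys {x} abs
    rewrite select-suc m | ++-assoc (select m) (filterᵇ P [ suc m ]) ys
          | indexOf-select-absent m (filterᵇ P [ suc m ] ++ ys) (absent-pred abs)
    with P (suc m) in e
  ... | true  = trans (cong (count m +_) (indexOf-cons (suc m) ys x (absent-≢ abs e))) (+-suc (count m) _)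
  ... | false = refl

  indexOf-select : ∀ m ys {x} → 1 ≤ x → x ≤ m → P x ≡ true →
    indexOf (select m ++ ys) x ≡ count (pred x)
  indexOf-select zero    ys 1≤x x≤0 _ = ⊥-elim (<⇒≱ 1≤x x≤0)
  indexOf-select (suc m) ys {x} 1≤x x≤ Px
    rewrite select-suc m | ++-assoc (select m) (filterᵇ P [ suc m ]) ys with m≤n⇒m<n∨m≡n x≤
  ... | inj₁ (s≤s x≤m) = indexOf-select m (filterᵇ P [ suc m ] ++ ys) 1≤x x≤m Px
  ... | inj₂ refl rewrite indexOf-select-absent m (filterᵇ P [ suc m ] ++ ys) (inj₁ (n<1+n m)) | Px
                        | indexOf-head (suc m) ys = +-identityʳ (count m)

  indexOf-reverse-select : ∀ m {x} → 1 ≤ x → x ≤ m → P x ≡ true →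
    indexOf (reverse (select m)) x ≡ count m ∸ count x
  indexOf-reverse-select zero 1≤x x≤0 _ = ⊥-elim (<⇒≱ 1≤x x≤0)
  indexOf-reverse-select (suc m) {x} 1≤x x≤ Px
    rewrite select-suc m | reverse-++ (select m) (filterᵇ P [ suc m ])
    with P (suc m) in e | m≤n⇒m<n∨m≡n x≤
  ... | true  | inj₂ refl rewrite indexOf-head (suc m) (reverse (select m)) | e =
    sym (n∸n≡0 (suc (count m)))
  ... | true  | inj₁ (s≤s x≤m)
    rewrite indexOf-cons (suc m) (reverse (select m)) x (λ q → <-irrefl (sym q) (s≤s x≤m))
          | indexOf-reverse-select m 1≤x x≤m Px = sym (+-∸-assoc 1 (count-mono x≤m))
  ... | false | inj₁ (s≤s x≤m) = indexOf-reverse-select m 1≤x x≤m Px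
  ... | false | inj₂ refl with trans (sym Px) e
  ...   | ()

count-complement : ∀ (P : ℕ → Bool) x → Count.count P x + Count.count (not ∘ P) x ≡ x
count-complement P zero = refl
count-complement P (suc x) with P (suc x)
... | true  = cong suc (count-complement P x)
... | false = trans (+-suc _ _) (cong suc (count-complement P x))

≡ᵖ-refl : ∀ d → (d ≡ᵖ d) ≡ true
≡ᵖ-refl (x , y) rewrite ≡ᵇ-refl x | ≡ᵇ-refl y = refl

≡ᵖ-true⇒≡ : ∀ d e → (d ≡ᵖ e) ≡ true → d ≡ e
≡ᵖ-true⇒≡ (x , y) (u , v) eq with x ≡ᵇ u in e₁ | y ≡ᵇ v in e₂
... | true  | true  = cong₂ _,_ (≡ᵇ-true⇒≡ x u e₁) (≡ᵇ-true⇒≡ y v e₂)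
... | true  | false with eq
...   | ()
≡ᵖ-true⇒≡ (x , y) (u , v) () | false | _

≡ᵖ-either⇒ : ∀ d p q → T ((d ≡ᵖ (p , q)) ∨ (d ≡ᵖ (q , p))) →
  d ≡ (p , q) ⊎ d ≡ (q , p)
≡ᵖ-either⇒ d p q t with d ≡ᵖ (p , q) in e
... | true  = inj₁ (≡ᵖ-true⇒≡ d (p , q) e)
... | false = inj₂ (≡ᵖ-true⇒≡ d (q , p) (Equivalence.to T-≡ t))

≡ᵖ-either⇐ : ∀ {d p q} → d ≡ (p , q) ⊎ d ≡ (q , p) →
  T ((d ≡ᵖ (p , q)) ∨ (d ≡ᵖ (q , p)))
≡ᵖ-either⇐ {p = p} {q} (inj₁ refl) rewrite ≡ᵖ-refl (p , q) = _
≡ᵖ-either⇐ {p = p} {q} (inj₂ refl) rewrite ≡ᵖ-refl (q , p) = Equivalence.from T-≡ (∨-zeroʳ _)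

¬Cross-from-zero : ∀ {l l′ u′} → l ≤ l′ → ¬ Cross (0 , l) (l′ , u′)
¬Cross-from-zero l≤l′ (inj₁ (_ , l′<l , _)) = <⇒≱ l′<l l≤l′
¬Cross-from-zero l≤l′ (inj₂ (() , _))

¬Cross-same-start : ∀ {p q s} → ¬ Cross (p , q) (p , s)
¬Cross-same-start (inj₁ (p<p , _)) = <-irrefl refl p<p
¬Cross-same-start (inj₂ (p<p , _)) = <-irrefl refl p<p

¬Cross-nested : ∀ {l u l′ u′} → l ≤ l′ → u′ ≤ u → ¬ Cross (l , u) (l′ , u′)
¬Cross-nested l≤l′ u′≤u (inj₁ (_ , _ , u<u′)) = <⇒≱ u<u′ u′≤u
¬Cross-nested l≤l′ u′≤u (inj₂ (l′<l , _ , _)) = <⇒≱ l′<l l≤l′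

module Polygon (n : ℕ) (2≤n : 2 ≤ n) (o : Orientation n) where

  up down : ℕ → Bool
  up   = isUp n o
  down = isDown n o

  module U = Count up
  module D = Count down

  #up #down : ℕ → ℕ
  #up   = U.count
  #down = D.count

  -- Counterclockwise, places 0, 1 … a, a+1, a+2 … a+b+1 carry 0, the down labels
  -- (increasing), n+1 and the up labels (decreasing).
  a b N : ℕ
  a = #down n
  b = #up n
  N = suc (suc n)

  #down+#up : ∀ x → #down x + #up x ≡ x
  #down+#up x = trans (+-comm (#down x) (#up x)) (count-complement up x)

  a+b≡n : a + b ≡ n
  a+b≡n = #down+#up n

  not-up⇒down : ∀ x → up x ≡ false → down x ≡ true
  not-up⇒down x = cong not

  down⇒not-up : ∀ x → down x ≡ true → up x ≡ false
  down⇒not-up x e with up x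
  ... | false = refl
  ... | true  with e
  ...   | ()

  down-n : down n ≡ true
  down-n with 2 ≤? n | (n ∸ 2) <? (n ∸ 2)
  ... | yes _ | yes p = ⊥-elim (<-irrefl refl p)
  ... | yes _ | no  _ = refl
  ... | no  _ | _     = refl

  up⇒<n : ∀ {i} → i ≤ n → up i ≡ true → i < n
  up⇒<n i≤n e with m≤n⇒m<n∨m≡n i≤n
  ... | inj₁ i<n = i<n
  ... | inj₂ refl with trans (sym e) (down⇒not-up n down-n)
  ...   | ()

  #down-range : ∀ {x} → 1 ≤ x → x ≤ n → down x ≡ true → 1 ≤ #down x × #down x ≤ a
  #down-range 1≤x x≤n e = D.count-< e 1≤x , D.count-mono x≤n

  #up-range : ∀ {x} → 1 ≤ x → x ≤ n → up x ≡ true → 1 ≤ #up x × #up x ≤ b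
  #up-range 1≤x x≤n e = U.count-< e 1≤x , U.count-mono x≤n

  #down<a : ∀ {K} → K < n → #down K < a
  #down<a K<n = D.count-< down-n K<n

  a≤n : a ≤ n
  a≤n = subst (a ≤_) a+b≡n (m≤m+n a b)

  a<N : suc a < N
  a<N = s≤s (s≤s a≤n)

  upPos : ℕ → ℕ
  upPos c = suc (suc (a + (b ∸ c)))

  upPos+c : ∀ {c} → c ≤ b → upPos c + c ≡ N
  upPos+c {c} c≤b =
    cong (suc ∘ suc) (trans (+-assoc a (b ∸ c) c) (trans (cong (a +_) (m∸n+n≡m c≤b)) a+b≡n))

  N∸upPos : ∀ {c} → c ≤ b → N ∸ upPos c ≡ c
  N∸upPos {c} c≤b = trans (cong (_∸ upPos c) (sym (upPos+c c≤b))) (m+n∸m≡n (upPos c) c)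

  a<upPos : ∀ c → suc a < upPos c
  a<upPos c = s≤s (s≤s (m≤m+n a _))

  upPos<N : ∀ {c} → 1 ≤ c → c ≤ b → upPos c < N
  upPos<N {c} 1≤c c≤b =
    s≤s (s≤s (subst (a + (b ∸ c) <_) a+b≡n (+-monoʳ-< a (∸-monoʳ-< 1≤c c≤b))))

  upPos-antitone : ∀ {c c′} → c′ ≤ c → upPos c ≤ upPos c′
  upPos-antitone c′≤c = s≤s (s≤s (+-monoʳ-≤ a (∸-monoʳ-≤ b c′≤c)))

  upPos-antitone⁻ : ∀ {c c′} → c′ ≤ b → upPos c ≤ upPos c′ → c′ ≤ c
  upPos-antitone⁻ {c} {c′} c′≤b h with c′ ≤? c
  ... | yes c′≤c = c′≤c
  ... | no  c′≰c =
    ⊥-elim (<⇒≱ (+-monoʳ-< a (∸-monoʳ-< (≰⇒> c′≰c) c′≤b)) (s≤s⁻¹ (s≤s⁻¹ h)))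

  upPos-injective : ∀ {c c′} → c ≤ b → c′ ≤ b → upPos c ≡ upPos c′ → c ≡ c′
  upPos-injective c≤b c′≤b eq =
    ∸-cancelˡ-≡ c≤b c′≤b (+-cancelˡ-≡ a _ _ (suc-injective (suc-injective eq)))

  suc-upPos : ∀ {c} → suc c ≤ b → suc (upPos (suc c)) ≡ upPos c
  suc-upPos {c} h = +-cancelʳ-≡ c _ _
    (trans (sym (+-suc (upPos (suc c)) c)) (trans (upPos+c h) (sym (upPos+c (≤-trans (n≤1+n c) h)))))

  place label : ℕ → ℕ
  place = pos n o
  label = lab n o

  upper-labels : List ℕ
  upper-labels = suc n ∷ reverse (U.select n)

  place-suc : ∀ x → place (suc x) ≡ suc (indexOf (D.select n ++ upper-labels) (suc x))
  place-suc x = indexOf-cons 0 (D.select n ++ upper-labels) (suc x) λ ()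

  place-down : ∀ {x} → 1 ≤ x → x ≤ n → down x ≡ true → place x ≡ #down x
  place-down {suc x} 1≤x x≤n e = begin
    place (suc x)
      ≡⟨ place-suc x ⟩
    suc (indexOf (D.select n ++ upper-labels) (suc x))
      ≡⟨ cong suc (D.indexOf-select n upper-labels 1≤x x≤n e) ⟩
    suc (#down x)
      ≡⟨ D.count-suc-true x e ⟨
    #down (suc x) ∎
    where open ≡-Reasoning

  place-top : place (suc n) ≡ suc a
  place-top = begin
    place (suc n)
      ≡⟨ place-suc n ⟩
    suc (indexOf (D.select n ++ upper-labels) (suc n))
      ≡⟨ cong suc (D.indexOf-select-absent n upper-labels (inj₁ (n<1+n n))) ⟩
    suc (a + indexOf upper-labels (suc n))
      ≡⟨ cong (λ k → suc (a + k)) (indexOf-head (suc n) (reverse (U.select n))) ⟩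
    suc (a + 0)
      ≡⟨ cong suc (+-identityʳ a) ⟩
    suc a ∎
    where open ≡-Reasoning

  place-up : ∀ {x} → 1 ≤ x → x ≤ n → up x ≡ true → place x ≡ upPos (#up x)
  place-up {suc x} 1≤x x≤n e = begin
    place (suc x)
      ≡⟨ place-suc x ⟩
    suc (indexOf (D.select n ++ upper-labels) (suc x))
      ≡⟨ cong suc (D.indexOf-select-absent n upper-labels (inj₂ (cong not e))) ⟩
    suc (a + indexOf upper-labels (suc x))
      ≡⟨ cong (λ k → suc (a + k)) (indexOf-cons (suc n) (reverse (U.select n)) (suc x) suc-n≢) ⟩
    suc (a + suc (indexOf (reverse (U.select n)) (suc x)))
      ≡⟨ cong (λ k → suc (a + suc k)) (U.indexOf-reverse-select n 1≤x x≤n e) ⟩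
    suc (a + suc (b ∸ #up (suc x)))
      ≡⟨ cong suc (+-suc a _) ⟩
    upPos (#up (suc x)) ∎
    where
    open ≡-Reasoning
    suc-n≢ : suc n ≢ suc x
    suc-n≢ q = <-irrefl (sym q) (s≤s x≤n)

  data Vertex : ℕ → Set where
    bottom : Vertex 0
    lower  : ∀ {x} → 1 ≤ x → x ≤ n → down x ≡ true → Vertex x
    top    : Vertex (suc n)
    upper  : ∀ {x} → 1 ≤ x → x ≤ n → up x ≡ true → Vertex x

  vertex : ∀ x → x ≤ suc n → Vertex x
  vertex zero    _ = bottom
  vertex (suc x) x≤ with m≤n⇒m<n∨m≡n x≤
  ... | inj₂ refl      = top
  ... | inj₁ (s≤s x<n) with bool-cases (up (suc x))
  ...   | inj₁ e = upper (s≤s z≤n) x<n e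
  ...   | inj₂ e = lower (s≤s z≤n) x<n (not-up⇒down (suc x) e)

  data Position : ℕ → Set where
    bottom : Position 0
    lower  : ∀ {p} → 1 ≤ p → p ≤ a → Position p
    top    : Position (suc a)
    upper  : ∀ {c} → 1 ≤ c → c ≤ b → Position (upPos c)

  position : ∀ p → p < N → Position p
  position zero    _ = bottom
  position (suc p) p< with suc p ≤? a
  ... | yes p≤a = lower (s≤s z≤n) p≤a
  ... | no  p≰a with m≤n⇒m<n∨m≡n (≰⇒> p≰a)
  ...   | inj₂ refl = top
  ...   | inj₁ a<p  = subst Position (cong suc shape) (upper (m<n⇒0<n∸m e<b) (m∸n≤m b e))
    where
    e = p ∸ suc a
    p≡ : p ≡ suc (a + e)
    p≡ = sym (m+[n∸m]≡n (s≤s⁻¹ a<p))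
    e<b : e < b
    e<b = +-cancelˡ-< a e b (s≤s⁻¹ (subst (λ z → suc (a + e) < suc z) (sym a+b≡n)
                                           (subst (_< suc n) p≡ (s≤s⁻¹ p<))))
    shape : suc (a + (b ∸ (b ∸ e))) ≡ p
    shape = sym (trans p≡ (cong (λ z → suc (a + z)) (sym (m∸[m∸n]≡n (<⇒≤ e<b)))))

  place<N : ∀ {x} → x ≤ suc n → place x < N
  place<N {x} x≤ with vertex x x≤
  ... | bottom = s≤s z≤n
  ... | lower 1≤x x≤n e rewrite place-down 1≤x x≤n e =
    <-trans (s≤s (proj₂ (#down-range 1≤x x≤n e))) a<N
  ... | top rewrite place-top = a<N
  ... | upper 1≤x x≤n e rewrite place-up 1≤x x≤n e = upPos<N (proj₁ range) (proj₂ range)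
    where range = #up-range 1≤x x≤n e

  length-labels : length (labels n o) ≡ N
  length-labels = cong suc (begin
    length (D.select n ++ upper-labels)
      ≡⟨ length-++ (D.select n) ⟩
    length (D.select n) + suc (length (reverse (U.select n)))
      ≡⟨ cong₂ (λ l r → l + suc r) (D.length-select n)
               (trans (length-reverse (U.select n)) (U.length-select n)) ⟩
    a + suc b
      ≡⟨ +-suc a b ⟩
    suc (a + b)
      ≡⟨ cong suc a+b≡n ⟩
    suc n ∎)
    where open ≡-Reasoning

  label-place : ∀ {x} → x ≤ suc n → label (place x) ≡ x
  label-place {x} x≤ = nth-indexOf (labels n o) x (subst (place x <_) (sym length-labels) (place<N x≤))

  label-top : label (suc a) ≡ suc n
  label-top = trans (cong label (sym place-top)) (label-place ≤-refl)

  label-lower : ∀ {p} → 1 ≤ p → p ≤ a →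
    Σ ℕ λ x → 1 ≤ x × x ≤ n × down x ≡ true × #down x ≡ p × label p ≡ x
  label-lower 1≤p p≤a with D.count-onto n 1≤p p≤a
  ... | x , 1≤x , x≤n , e , cx = x , 1≤x , x≤n , e , cx ,
    trans (cong label (sym (trans (place-down 1≤x x≤n e) cx))) (label-place (m≤n⇒m≤1+n x≤n))

  label-upper : ∀ {c} → 1 ≤ c → c ≤ b →
    Σ ℕ λ x → 1 ≤ x × x ≤ n × up x ≡ true × #up x ≡ c × label (upPos c) ≡ x
  label-upper 1≤c c≤b with U.count-onto n 1≤c c≤b
  ... | x , 1≤x , x≤n , e , cx = x , 1≤x , x≤n , e , cx ,
    trans (cong label (sym (trans (place-up 1≤x x≤n e) (cong upPos cx))))
          (label-place (m≤n⇒m≤1+n x≤n))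

  placed-bottom : ∀ {x} → x ≤ suc n → place x ≡ 0 → x ≡ 0
  placed-bottom x≤ eq = trans (sym (label-place x≤)) (cong label eq)

  placed-top : ∀ {x} → x ≤ suc n → place x ≡ suc a → x ≡ suc n
  placed-top x≤ eq = trans (sym (label-place x≤)) (trans (cong label eq) label-top)

  placed-lower : ∀ {x p} → x ≤ suc n → place x ≡ p → 1 ≤ p → p ≤ a →
    1 ≤ x × x ≤ n × down x ≡ true × #down x ≡ p
  placed-lower x≤ eq 1≤p p≤a with label-lower 1≤p p≤a
  ... | y , 1≤y , y≤n , e , cy , ly with trans (sym (label-place x≤)) (trans (cong label eq) ly)
  ...   | refl = 1≤y , y≤n , e , cy

  placed-upper : ∀ {x c} → x ≤ suc n → place x ≡ upPos c → 1 ≤ c → c ≤ b →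
    1 ≤ x × x ≤ n × up x ≡ true × #up x ≡ c
  placed-upper x≤ eq 1≤c c≤b with label-upper 1≤c c≤b
  ... | y , 1≤y , y≤n , e , cy , ly with trans (sym (label-place x≤)) (trans (cong label eq) ly)
  ...   | refl = 1≤y , y≤n , e , cy

  label≤suc-n : ∀ {p} → p < N → label p ≤ suc n
  label≤suc-n {p} p<N with position p p<N
  ... | bottom = z≤n
  ... | lower 1≤p p≤a = let (x , _ , x≤n , _ , _ , lx) = label-lower 1≤p p≤a in
                        subst (_≤ suc n) (sym lx) (m≤n⇒m≤1+n x≤n)
  ... | top = ≤-reflexive label-top
  ... | upper 1≤c c≤b = let (x , _ , x≤n , _ , _ , lx) = label-upper 1≤c c≤b in
                        subst (_≤ suc n) (sym lx) (m≤n⇒m≤1+n x≤n)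

  label-monotone-lower : ∀ {p q} → p ≤ q → q ≤ suc a → label p ≤ label q
  label-monotone-lower {zero}  _   _  = z≤n
  label-monotone-lower {suc p} {q} p≤q q≤ with m≤n⇒m<n∨m≡n q≤
  ... | inj₂ refl = subst (label (suc p) ≤_) (sym label-top) (label≤suc-n (<-≤-trans (s≤s p≤q) a<N))
  ... | inj₁ (s≤s q≤a)
    with label-lower (s≤s z≤n) (≤-trans p≤q q≤a) | label-lower (≤-trans (s≤s z≤n) p≤q) q≤a
  ...   | x , _ , _ , dx , cx , lx | y , _ , _ , _ , cy , ly =
    subst₂ _≤_ (sym lx) (sym ly) (D.count-≤⇒≤ dx (subst₂ _≤_ (sym cx) (sym cy) p≤q))

  label-antitone-upper : ∀ {p q} → suc a ≤ p → p ≤ q → q < N → label q ≤ label p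
  label-antitone-upper {p} {q} a<p p≤q q<N with position p (≤-<-trans p≤q q<N) | position q q<N
  ... | bottom        | _ = ⊥-elim (<⇒≱ (s≤s z≤n) a<p)
  ... | lower _ p≤a   | _ = ⊥-elim (<⇒≱ (s≤s p≤a) a<p)
  ... | top           | _ = subst (label q ≤_) (sym label-top) (label≤suc-n q<N)
  ... | upper _ _     | bottom      = ⊥-elim (<⇒≱ (s≤s z≤n) (≤-trans a<p p≤q))
  ... | upper _ _     | lower _ q≤a = ⊥-elim (<⇒≱ (s≤s q≤a) (≤-trans a<p p≤q))
  ... | upper {c} _ _ | top         = ⊥-elim (<⇒≱ (a<upPos c) p≤q)
  ... | upper 1≤c c≤b | upper 1≤c′ c′≤b with label-upper 1≤c c≤b | label-upper 1≤c′ c′≤b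
  ...   | x , _ , _ , _ , cx , lx | y , _ , _ , uy , cy , ly =
    subst₂ _≤_ (sym ly) (sym lx)
      (U.count-≤⇒≤ uy (subst₂ _≤_ (sym cy) (sym cx) (upPos-antitone⁻ c′≤b p≤q)))

  μ : ℕ → ℕ → ℕ
  μ = mu n o

  arcLength : ℕ → ℕ → ℕ
  arcLength s t = (t + N ∸ s) % N

  -- The test `mu` applies to the labels on the counterclockwise arc from i to j
  -- (definitionally its local `allowed`).
  allowed : ℕ → ℕ → ℕ → Bool
  allowed i j c = if j <ᵇ i then c ≤ᵇ i else i ≤ᵇ c

  onArc : ℕ → ℕ → ℕ → Bool
  onArc i j k = allowed i j (label ((place i + k) % N))

  onArc-at : ∀ i j {k p} → (place i + k) % N ≡ p → onArc i j k ≡ allowed i j (label p)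
  onArc-at i j = cong (allowed i j ∘ label)

  μ-ccw : ∀ {i j d} → arcLength (place i) (place j) ≡ d →
    (∀ k → k ≤ d → onArc i j k ≡ true) → μ i j ≡ d
  μ-ccw {i} {j} {d} e ok
    rewrite e | all-upTo-true (onArc i j) (suc d) (λ k k< → ok k (s≤s⁻¹ k<)) = refl

  μ-cw : ∀ {i j d} k → arcLength (place i) (place j) ≡ d → k ≤ d →
    onArc i j k ≡ false → μ i j ≡ N ∸ d
  μ-cw {i} {j} {d} k e k≤d blocked
    rewrite e | all-upTo-false (onArc i j) {suc d} k (s≤s k≤d) blocked = refl

  allowed-self : ∀ i j → allowed i j i ≡ true
  allowed-self i j with j <ᵇ i
  ... | true  = ≤ᵇ-true (≤-refl {i})
  ... | false = ≤ᵇ-true (≤-refl {i})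

  allowed-other : ∀ i j → allowed i j j ≡ true
  allowed-other i j with j <ᵇ i in e
  ... | true  = ≤ᵇ-true (<⇒≤ (<ᵇ-true⇒< j i e))
  ... | false = ≤ᵇ-true (<ᵇ-false⇒≥ j i e)

  allowed-below : ∀ {i j} c → j < i → allowed i j c ≡ (c ≤ᵇ i)
  allowed-below c j<i rewrite <ᵇ-true j<i = refl

  allowed-above : ∀ {i j} c → i ≤ j → allowed i j c ≡ (i ≤ᵇ c)
  allowed-above {i} {j} c i≤j rewrite <ᵇ-false {j} {i} i≤j = refl

  arcLength-straight : ∀ {s t} → s ≤ t → t < N → arcLength s t ≡ t ∸ s
  arcLength-straight {s} {t} s≤t t<N =
    trans (cong (_% N) (+-∸-comm N s≤t))
          (trans ([m+n]%n≡m%n (t ∸ s) N) (m<n⇒m%n≡m (≤-<-trans (m∸n≤m t s) t<N)))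

  arcLength-wrapping : ∀ {s t} → t < s → s ≤ N → arcLength s t ≡ t + (N ∸ s)
  arcLength-wrapping {s} {t} t<s s≤N = trans (cong (_% N) (+-∸-assoc t s≤N)) (m<n⇒m%n≡m t+N∸s<N)
    where
    t+N∸s<N : t + (N ∸ s) < N
    t+N∸s<N = subst (t + (N ∸ s) <_) (m+[n∸m]≡n s≤N) (+-monoˡ-< (N ∸ s) t<s)

  wrap-around : ∀ {s} q → s ≤ N → (s + ((N ∸ s) + q)) % N ≡ q % N
  wrap-around {s} q s≤N = begin
    (s + ((N ∸ s) + q)) % N ≡⟨ cong (_% N) (sym (+-assoc s (N ∸ s) q)) ⟩
    (s + (N ∸ s) + q) % N   ≡⟨ cong (λ z → (z + q) % N) (m+[n∸m]≡n s≤N) ⟩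
    (N + q) % N             ≡⟨ cong (_% N) (+-comm N q) ⟩
    (q + N) % N             ≡⟨ [m+n]%n≡m%n q N ⟩
    q % N                   ∎
    where open ≡-Reasoning

  OkOn : ℕ → ℕ → (ℕ → Set) → Set
  OkOn i j Range = ∀ p → Range p → allowed i j (label p) ≡ true

  μ-straight : ∀ {i j} → j ≤ suc n → place i ≤ place j →
    OkOn i j (λ p → place i ≤ p × p ≤ place j) → μ i j ≡ place j ∸ place i
  μ-straight {i} {j} j≤ s≤t ok = μ-ccw {i} {j} (arcLength-straight s≤t t<N) onArc-ok
    where
    s = place i
    t = place j
    t<N = place<N j≤
    onArc-ok : ∀ k → k ≤ t ∸ s → onArc i j k ≡ true
    onArc-ok k k≤ =
      trans (onArc-at i j (m<n⇒m%n≡m (≤-<-trans s+k≤t t<N))) (ok (s + k) (m≤m+n s k , s+k≤t))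
      where
      s+k≤t : s + k ≤ t
      s+k≤t = subst (s + k ≤_) (m+[n∸m]≡n s≤t) (+-monoʳ-≤ s k≤)

  μ-straight-blocked : ∀ {i j} p → j ≤ suc n → place i ≤ p → p ≤ place j →
    allowed i j (label p) ≡ false → μ i j ≡ N ∸ (place j ∸ place i)
  μ-straight-blocked {i} {j} p j≤ s≤p p≤t blocked =
    μ-cw {i} {j} (p ∸ place i) (arcLength-straight (≤-trans s≤p p≤t) (place<N j≤))
      (∸-monoˡ-≤ (place i) p≤t)
      (trans (onArc-at i j (trans (cong (_% N) (m+[n∸m]≡n s≤p))
                                  (m<n⇒m%n≡m (≤-<-trans p≤t (place<N j≤)))))
             blocked)

  μ-wrapping : ∀ {i j} → i ≤ suc n → place j < place i →
    OkOn i j (λ p → place i ≤ p × p < N) → OkOn i j (_≤ place j) → μ i j ≡ place j + (N ∸ place i)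
  μ-wrapping {i} {j} i≤ t<s okUpper okLower = μ-ccw {i} {j} (arcLength-wrapping t<s s≤N) onArc-ok
    where
    s = place i
    t = place j
    s≤N = <⇒≤ (place<N i≤)
    onArc-ok : ∀ k → k ≤ t + (N ∸ s) → onArc i j k ≡ true
    onArc-ok k k≤ with k <? N ∸ s
    ... | yes k<N∸s = trans (onArc-at i j (m<n⇒m%n≡m s+k<N)) (okUpper (s + k) (m≤m+n s k , s+k<N))
      where
      s+k<N : s + k < N
      s+k<N = subst (s + k <_) (m+[n∸m]≡n s≤N) (+-monoʳ-< s k<N∸s)
    ... | no  k≮N∸s = trans (onArc-at i j position-q) (okLower q q≤t)
      where
      q = k ∸ (N ∸ s)
      k≡ : k ≡ (N ∸ s) + q
      k≡ = sym (m+[n∸m]≡n (≮⇒≥ k≮N∸s))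
      q≤t : q ≤ t
      q≤t = +-cancelˡ-≤ (N ∸ s) q t
              (subst (_≤ (N ∸ s) + t) k≡ (≤-trans k≤ (≤-reflexive (+-comm t (N ∸ s)))))
      position-q : (s + k) % N ≡ q
      position-q = trans (cong (λ z → (s + z) % N) k≡)
                         (trans (wrap-around q s≤N) (m<n⇒m%n≡m (≤-<-trans q≤t (<-≤-trans t<s s≤N))))

  μ-wrapping-blocked : ∀ {i j} p → i ≤ suc n → place j < place i →
    (place i ≤ p × p < N) ⊎ p ≤ place j →
    allowed i j (label p) ≡ false → μ i j ≡ N ∸ (place j + (N ∸ place i))
  μ-wrapping-blocked {i} {j} p i≤ t<s (inj₁ (s≤p , p<N)) blocked =
    μ-cw {i} {j} (p ∸ place i) (arcLength-wrapping t<s s≤N)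
      (≤-trans (∸-monoˡ-≤ (place i) (<⇒≤ p<N)) (m≤n+m (N ∸ place i) (place j)))
      (trans (onArc-at i j (trans (cong (_% N) (m+[n∸m]≡n s≤p)) (m<n⇒m%n≡m p<N))) blocked)
    where s≤N = <⇒≤ (place<N i≤)
  μ-wrapping-blocked {i} {j} p i≤ t<s (inj₂ p≤t) blocked =
    μ-cw {i} {j} ((N ∸ place i) + p) (arcLength-wrapping t<s s≤N)
      (≤-trans (+-monoʳ-≤ (N ∸ place i) p≤t) (≤-reflexive (+-comm _ (place j))))
      (trans (onArc-at i j (trans (wrap-around p s≤N) (m<n⇒m%n≡m (≤-<-trans p≤t (<-≤-trans t<s s≤N)))))
             blocked)
    where s≤N = <⇒≤ (place<N i≤)

  top-blocked : ∀ {i j} → j < i → i ≤ n → allowed i j (label (suc a)) ≡ false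
  top-blocked j<i i≤n =
    trans (allowed-below _ j<i) (trans (cong (_≤ᵇ _) label-top) (≤ᵇ-false (s≤s i≤n)))

  bottom-blocked : ∀ {i j} → 1 ≤ i → i ≤ j → allowed i j (label 0) ≡ false
  bottom-blocked 1≤i i≤j = trans (allowed-above 0 i≤j) (≤ᵇ-false 1≤i)

  arcLength-next : ∀ {s} → s < N → arcLength s (suc s % N) ≡ 1
  arcLength-next {s} s<N with m≤n⇒m<n∨m≡n s<N
  ... | inj₁ s+1<N = trans (cong (arcLength s) (m<n⇒m%n≡m s+1<N))
                           (trans (arcLength-straight (n≤1+n s) s+1<N) (m+n∸n≡m 1 s))
  ... | inj₂ refl  = trans (cong (arcLength s) (n%n≡0 N))
                           (trans (arcLength-wrapping (s≤s z≤n) (n≤1+n s)) (m+n∸n≡m 1 s))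

  μ-next : ∀ {i j} → i ≤ suc n → j ≤ suc n → suc (place i) % N ≡ place j → μ i j ≡ 1
  μ-next {i} {j} i≤ j≤ next =
    μ-ccw {i} {j} (trans (cong (arcLength (place i)) (sym next)) (arcLength-next (place<N i≤))) endpoints
    where
    endpoints : ∀ k → k ≤ 1 → onArc i j k ≡ true
    endpoints zero          _ =
      trans (onArc-at i j (trans (cong (_% N) (+-identityʳ (place i))) (m<n⇒m%n≡m (place<N i≤))))
            (trans (cong (allowed i j) (label-place i≤)) (allowed-self i j))
    endpoints (suc zero)    _ =
      trans (onArc-at i j (trans (cong (_% N) (+-comm (place i) 1)) next))
            (trans (cong (allowed i j) (label-place j≤)) (allowed-other i j))
    endpoints (suc (suc k)) (s≤s ())

  -- The counterclockwise arc from i to its clockwise neighbour j is the whole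
  -- boundary, which contains a forbidden label (0 or n+1).
  μ-prev : ∀ {i j} → 1 ≤ i → i ≤ n → j ≤ suc n → suc (place j) % N ≡ place i → μ i j ≡ 1
  μ-prev {i} {j} 1≤i i≤n j≤ next =
    trans (μ-wrapping-blocked p i≤ (subst (t <_) (sym s≡) (n<1+n t)) (covered p p<N) blocked)
          (trans (cong (N ∸_) arc) (m+n∸n≡m 1 (suc n)))
    where
    s = place i
    t = place j
    i≤ = m≤n⇒m≤1+n i≤n
    s≡ : s ≡ suc t
    s≡ with m≤n⇒m<n∨m≡n (place<N j≤)
    ... | inj₁ t+1<N = trans (sym next) (m<n⇒m%n≡m t+1<N)
    ... | inj₂ t+1≡N = ⊥-elim (<⇒≱ 1≤i (≤-reflexive (placed-bottom i≤
                         (trans (sym next) (trans (cong (_% N) t+1≡N) (n%n≡0 N))))))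
    forbidden : Σ ℕ λ p → p < N × allowed i j (label p) ≡ false
    forbidden with j <? i
    ... | yes j<i = suc a , a<N , top-blocked j<i i≤n
    ... | no  j≮i = 0 , s≤s z≤n , bottom-blocked 1≤i (≮⇒≥ j≮i)
    p = proj₁ forbidden
    p<N = proj₁ (proj₂ forbidden)
    blocked = proj₂ (proj₂ forbidden)
    covered : ∀ p → p < N → (s ≤ p × p < N) ⊎ p ≤ t
    covered p p<N with p ≤? t
    ... | yes p≤t = inj₂ p≤t
    ... | no  p≰t = inj₁ (subst (_≤ p) (sym s≡) (≰⇒> p≰t) , p<N)
    arc : t + (N ∸ s) ≡ suc n
    arc = suc-injective (trans (cong (_+ (N ∸ s)) (sym s≡)) (m+[n∸m]≡n (<⇒≤ (place<N i≤))))

  μ-upward : ∀ {i j} → i ≤ suc n → j ≤ suc n → i < j →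
    place i ≤ suc a → suc a ≤ place j → μ i j ≡ place j ∸ place i
  μ-upward {i} {j} i≤ j≤ i<j s≤top top≤t = μ-straight j≤ (≤-trans s≤top top≤t) ok
    where
    ok : OkOn i j (λ p → place i ≤ p × p ≤ place j)
    ok p (s≤p , p≤t) = trans (allowed-above (label p) (<⇒≤ i<j)) (≤ᵇ-true i≤label)
      where
      i≤label : i ≤ label p
      i≤label with p ≤? suc a
      ... | yes p≤top = subst (_≤ label p) (label-place i≤) (label-monotone-lower s≤p p≤top)
      ... | no  p≰top = <⇒≤ (<-≤-trans i<j (subst (_≤ label p) (label-place j≤)
                              (label-antitone-upper (<⇒≤ (≰⇒> p≰top)) p≤t (place<N j≤))))

  μ-downward : ∀ {i j} → i ≤ suc n → j ≤ suc n → j < i →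
    place j ≤ suc a → suc a ≤ place i → place j < place i → μ i j ≡ place j + (N ∸ place i)
  μ-downward {i} {j} i≤ j≤ j<i t≤top top≤s t<s = μ-wrapping i≤ t<s okUpper okLower
    where
    okUpper : OkOn i j (λ p → place i ≤ p × p < N)
    okUpper p (s≤p , p<N) = trans (allowed-below (label p) j<i) (≤ᵇ-true
      (subst (label p ≤_) (label-place i≤) (label-antitone-upper top≤s s≤p p<N)))
    okLower : OkOn i j (_≤ place j)
    okLower p p≤t = trans (allowed-below (label p) j<i) (≤ᵇ-true
      (<⇒≤ (≤-<-trans (subst (label p ≤_) (label-place j≤) (label-monotone-lower p≤t t≤top)) j<i)))

  μ-blocked-top-straight : ∀ {i j} → i ≤ n → j ≤ suc n → j < i →
    place i ≤ suc a → suc a ≤ place j → μ i j ≡ N ∸ (place j ∸ place i)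
  μ-blocked-top-straight i≤n j≤ j<i s≤top top≤t =
    μ-straight-blocked (suc a) j≤ s≤top top≤t (top-blocked j<i i≤n)

  μ-blocked-top-wrapping : ∀ {i j} → i ≤ n → j < i →
    place j < place i → place i ≤ suc a → μ i j ≡ N ∸ (place j + (N ∸ place i))
  μ-blocked-top-wrapping i≤n j<i t<s s≤top =
    μ-wrapping-blocked (suc a) (m≤n⇒m≤1+n i≤n) t<s (inj₁ (s≤top , a<N)) (top-blocked j<i i≤n)

  μ-blocked-bottom : ∀ {i j} → 1 ≤ i → i ≤ n → i ≤ j →
    place j < place i → μ i j ≡ N ∸ (place j + (N ∸ place i))
  μ-blocked-bottom 1≤i i≤n i≤j t<s =
    μ-wrapping-blocked 0 (m≤n⇒m≤1+n i≤n) t<s (inj₂ z≤n) (bottom-blocked 1≤i i≤j)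

  Joined : List (ℕ × ℕ) → ℕ → ℕ → Set
  Joined D x i = Any (λ d → d ≡ (place x , place i) ⊎ d ≡ (place i , place x)) D

  Side : List (ℕ × ℕ) → ℕ → ℕ → Set
  Side D p q = (suc p % N ≡ q) ⊎ (suc q % N ≡ p) ⊎ Any (λ d → d ≡ (p , q) ⊎ d ≡ (q , p)) D

  adjPos⇒ : ∀ D p q → adjPos n D p q ≡ true → Side D p q
  adjPos⇒ D p q adj with (suc p % N ≡ᵇ q) in e₁
  ... | true  = inj₁ (≡ᵇ-true⇒≡ _ q e₁)
  ... | false with (suc q % N ≡ᵇ p) in e₂
  ...   | true  = inj₂ (inj₁ (≡ᵇ-true⇒≡ _ p e₂))
  ...   | false = inj₂ (inj₂ (Any.map (≡ᵖ-either⇒ _ p q) (Anyₚ.any⁻ _ D (subst T (sym adj) _))))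

  adjPos-next : ∀ D p q → suc p % N ≡ q → adjPos n D p q ≡ true
  adjPos-next D p q e rewrite e | ≡ᵇ-refl q = refl

  adjPos-prev : ∀ D p q → suc q % N ≡ p → adjPos n D p q ≡ true
  adjPos-prev D p q e rewrite e | ≡ᵇ-refl p = ∨-zeroʳ (suc p % N ≡ᵇ q)

  adjPos-diagonal : ∀ D {p q} → Any (λ d → d ≡ (p , q) ⊎ d ≡ (q , p)) D → adjPos n D p q ≡ true
  adjPos-diagonal D {p} {q} h rewrite Equivalence.to T-≡ (Anyₚ.any⁺ _ (Any.map ≡ᵖ-either⇐ h)) =
    trans (cong ((suc p % N ≡ᵇ q) ∨_) (∨-zeroʳ (suc q % N ≡ᵇ p))) (∨-zeroʳ _)

  left-neighbour : ∀ D {i x} → 1 ≤ i → i ≤ n → x ≤ suc n → adjLab n o D x i ≡ true →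
    μ i x ≡ 1 ⊎ Joined D x i
  left-neighbour D 1≤i i≤n x≤ adj with adjPos⇒ D _ _ adj
  ... | inj₁ next          = inj₁ (μ-prev 1≤i i≤n x≤ next)
  ... | inj₂ (inj₁ prev)   = inj₁ (μ-next (m≤n⇒m≤1+n i≤n) x≤ prev)
  ... | inj₂ (inj₂ joined) = inj₂ joined

  right-neighbour : ∀ D {i x} → 1 ≤ i → i ≤ n → x ≤ suc n → adjLab n o D i x ≡ true →
    μ i x ≡ 1 ⊎ Joined D x i
  right-neighbour D 1≤i i≤n x≤ adj with adjPos⇒ D _ _ adj
  ... | inj₁ next          = inj₁ (μ-next (m≤n⇒m≤1+n i≤n) x≤ next)
  ... | inj₂ (inj₁ prev)   = inj₁ (μ-prev 1≤i i≤n x≤ prev)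
  ... | inj₂ (inj₂ joined) = inj₂ (Any.map swap joined)
    where
    swap : ∀ {d e f} → d ≡ e ⊎ d ≡ f → d ≡ f ⊎ d ≡ e
    swap (inj₁ eq) = inj₂ eq
    swap (inj₂ eq) = inj₁ eq

  LeftWitness RightWitness : List (ℕ × ℕ) → ℕ → ℕ → Set
  LeftWitness  D i V = Σ ℕ λ x → x < i × adjLab n o D x i ≡ true × μ i x ≡ V
  RightWitness D i V = Σ ℕ λ y → i < y × y ≤ suc n × adjLab n o D i y ≡ true × μ i y ≡ V

  -- Sides of the polygon contribute μ = 1, so only diagonals need bounding.
  pl≡ : ∀ D {i V} → 1 ≤ i → i ≤ n → 1 ≤ V →
    (∀ {x} → x ≤ suc n → x < i → Joined D x i → μ i x ≤ V) →
    LeftWitness D i V → pl n o D i ≡ V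
  pl≡ D {i} {V} 1≤i i≤n 1≤V joined-≤ (x , x<i , adj , attained) =
    maximum-filter≡ (μ i) (λ x → adjLab n o D x i) (upTo i)
      (Allₚ.applyUpTo⁺₁ id i bounded) (Anyₚ.applyUpTo⁺ id (adj , attained) x<i)
    where
    bounded : ∀ {x} → x < i → adjLab n o D x i ≡ true → μ i x ≤ V
    bounded x<i adj =
      [ (λ μ≡1 → subst (_≤ V) (sym μ≡1) 1≤V) , joined-≤ x≤ x<i ]′ (left-neighbour D 1≤i i≤n x≤ adj)
      where x≤ = ≤-trans (<⇒≤ x<i) (m≤n⇒m≤1+n i≤n)

  pr≡ : ∀ D {i V} → 1 ≤ i → i ≤ n → 1 ≤ V →
    (∀ {y} → y ≤ suc n → i < y → Joined D y i → μ i y ≤ V) →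
    RightWitness D i V → pr n o D i ≡ V
  pr≡ D {i} {V} 1≤i i≤n 1≤V joined-≤ (y , i<y , y≤ , adj , attained) =
    maximum-filter≡ (μ i) (λ y → adjLab n o D i y) _
      (Allₚ.map⁺ (Allₚ.applyUpTo⁺₁ id (suc n ∸ i)
                   (λ {k} k< → bounded (in-range k<) (s≤s (m≤m+n i k)))))
      (Anyₚ.map⁺ (Anyₚ.applyUpTo⁺ id {y ∸ suc i}
        (subst (λ z → adjLab n o D i z ≡ true × μ i z ≡ V) (sym y≡) (adj , attained)) offset<))
    where
    i≤ = m≤n⇒m≤1+n i≤n
    bounded : ∀ {y} → y ≤ suc n → i < y → adjLab n o D i y ≡ true → μ i y ≤ V
    bounded y≤ i<y adj =
      [ (λ μ≡1 → subst (_≤ V) (sym μ≡1) 1≤V) , joined-≤ y≤ i<y ]′ (right-neighbour D 1≤i i≤n y≤ adj)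
    in-range : ∀ {k} → k < suc n ∸ i → suc i + k ≤ suc n
    in-range {k} k< = subst (suc (i + k) ≤_) (m+[n∸m]≡n i≤) (+-monoʳ-< i k<)
    y≡ : suc i + (y ∸ suc i) ≡ y
    y≡ = m+[n∸m]≡n i<y
    offset< : y ∸ suc i < suc n ∸ i
    offset< = +-cancelˡ-< i (y ∸ suc i) (suc n ∸ i)
      (subst₂ _≤_ refl (sym (m+[n∸m]≡n i≤)) (subst (_≤ suc n) (sym y≡) y≤))

  n∸1+1 : suc (n ∸ 1) ≡ n
  n∸1+1 = m+[n∸m]≡n {1} {n} (≤-trans (s≤s z≤n) 2≤n)

  cuts : (ℕ → ℕ × ℕ) → List (ℕ × ℕ)
  cuts f = applyUpTo (f ∘ suc) (n ∸ 1)

  cuts-isTriangulation : ∀ f → (∀ {K} → 1 ≤ K → K < n → IsDiagonal n (f K)) →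
    (∀ {K K′} → K < K′ → K′ < n → f K ≢ f K′ × ¬ Cross (f K) (f K′)) →
    IsTriangulation n (cuts f)
  cuts-isTriangulation f diagonal compatible =
    length-applyUpTo (f ∘ suc) (n ∸ 1) ,
    Allₚ.applyUpTo⁺₁ (f ∘ suc) (n ∸ 1) (λ k< → diagonal (s≤s z≤n) (bound k<)) ,
    AllPairsₚ.applyUpTo⁺₁ (f ∘ suc) (n ∸ 1) (λ k<k′ k′< → compatible (s≤s k<k′) (bound k′<))
    where
    bound : ∀ {k} → k < n ∸ 1 → suc k < n
    bound k< = subst (_ <_) n∸1+1 (s≤s k<)

  ∈cuts : ∀ f {P : ℕ × ℕ → Set} → Any P (cuts f) → Σ ℕ λ K → 1 ≤ K × K < n × P (f K)
  ∈cuts f on with Anyₚ.applyUpTo⁻ (f ∘ suc) on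
  ... | k , k< , p = suc k , s≤s z≤n , subst (_ <_) n∸1+1 (s≤s k<) , p

  cuts∋ : ∀ f {P : ℕ × ℕ → Set} {K} → 1 ≤ K → K < n → P (f K) → Any P (cuts f)
  cuts∋ f {K = suc k} _ K<n p = Anyₚ.applyUpTo⁺ (f ∘ suc) p (s≤s⁻¹ (subst (_ <_) (sym n∸1+1) K<n))

  cut-adjacent : ∀ f {K p q} → 1 ≤ K → K < n → f K ≡ (p , q) ⊎ f K ≡ (q , p) →
    adjPos n (cuts f) p q ≡ true
  cut-adjacent f 1≤K K<n on = adjPos-diagonal (cuts f) (cuts∋ f 1≤K K<n on)

  place-down-range : ∀ {x} → 1 ≤ x → x ≤ n → down x ≡ true → 1 ≤ place x × place x ≤ a
  place-down-range 1≤x x≤n e rewrite place-down 1≤x x≤n e = #down-range 1≤x x≤n e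

  a<place-up : ∀ {x} → 1 ≤ x → x ≤ n → up x ≡ true → suc a < place x
  a<place-up {x} 1≤x x≤n e = subst (suc a <_) (sym (place-up 1≤x x≤n e)) (a<upPos (#up x))

  N∸[upPos∸s] : ∀ {c s} → c ≤ b → s ≤ upPos c → N ∸ (upPos c ∸ s) ≡ s + c
  N∸[upPos∸s] {c} {s} c≤b s≤u = begin
    N ∸ (upPos c ∸ s)
      ≡⟨ cong (_∸ (upPos c ∸ s)) (trans (sym (upPos+c c≤b)) (+-comm (upPos c) c)) ⟩
    c + upPos c ∸ (upPos c ∸ s)
      ≡⟨ +-∸-assoc c (m∸n≤m (upPos c) s) ⟩
    c + (upPos c ∸ (upPos c ∸ s))
      ≡⟨ cong (c +_) (m∸[m∸n]≡n s≤u) ⟩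
    c + s
      ≡⟨ +-comm c s ⟩
    s + c ∎
    where open ≡-Reasoning

  μ-down-bottom : ∀ {i} → 1 ≤ i → i ≤ n → down i ≡ true → μ i 0 ≡ #down i
  μ-down-bottom {i} 1≤i i≤n di = begin
    μ i 0
      ≡⟨ μ-blocked-top-wrapping i≤n 1≤i 0<s (≤-trans s≤a (n≤1+n a)) ⟩
    N ∸ (N ∸ place i)
      ≡⟨ m∸[m∸n]≡n (<⇒≤ (place<N (m≤n⇒m≤1+n i≤n))) ⟩
    place i
      ≡⟨ place-down 1≤i i≤n di ⟩
    #down i ∎
    where
    open ≡-Reasoning
    0<s = proj₁ (place-down-range 1≤i i≤n di)
    s≤a = proj₂ (place-down-range 1≤i i≤n di)

  μ-down-up : ∀ {i x} → 1 ≤ i → i ≤ n → down i ≡ true → 1 ≤ x → x ≤ n → up x ≡ true → x < i →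
    μ i x ≡ #down i + #up x
  μ-down-up {i} {x} 1≤i i≤n di 1≤x x≤n ux x<i = begin
    μ i x
      ≡⟨ μ-blocked-top-straight i≤n (m≤n⇒m≤1+n x≤n) x<i (≤-trans s≤a (n≤1+n a))
                                (<⇒≤ (a<place-up 1≤x x≤n ux)) ⟩
    N ∸ (place x ∸ place i)
      ≡⟨ cong₂ (λ t s → N ∸ (t ∸ s)) (place-up 1≤x x≤n ux) (place-down 1≤i i≤n di) ⟩
    N ∸ (upPos (#up x) ∸ #down i)
      ≡⟨ N∸[upPos∸s] (proj₂ (#up-range 1≤x x≤n ux))
                     (≤-trans #down≤a (≤-trans (n≤1+n a) (<⇒≤ (a<upPos (#up x))))) ⟩
    #down i + #up x ∎
    where
    open ≡-Reasoning
    s≤a = proj₂ (place-down-range 1≤i i≤n di)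
    #down≤a = proj₂ (#down-range 1≤i i≤n di)

  μ-up-down : ∀ {i y} → 1 ≤ i → i ≤ n → up i ≡ true → 1 ≤ y → y ≤ n → down y ≡ true → i < y →
    μ i y ≡ N ∸ (#down y + #up i)
  μ-up-down {i} {y} 1≤i i≤n ui 1≤y y≤n dy i<y = begin
    μ i y
      ≡⟨ μ-blocked-bottom 1≤i i≤n (<⇒≤ i<y) t<s ⟩
    N ∸ (place y + (N ∸ place i))
      ≡⟨ cong₂ (λ t s → N ∸ (t + (N ∸ s))) (place-down 1≤y y≤n dy) (place-up 1≤i i≤n ui) ⟩
    N ∸ (#down y + (N ∸ upPos (#up i)))
      ≡⟨ cong (λ z → N ∸ (#down y + z)) (N∸upPos (proj₂ (#up-range 1≤i i≤n ui))) ⟩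
    N ∸ (#down y + #up i) ∎
    where
    open ≡-Reasoning
    t<s = <-trans (≤-<-trans (proj₂ (place-down-range 1≤y y≤n dy)) (n<1+n a)) (a<place-up 1≤i i≤n ui)

  μ-down-above : ∀ {i y} → 1 ≤ i → i ≤ n → down i ≡ true → y ≤ suc n → i < y → suc a ≤ place y →
    μ i y ≡ place y ∸ #down i
  μ-down-above {i} {y} 1≤i i≤n di y≤ i<y top≤t =
    trans (μ-upward (m≤n⇒m≤1+n i≤n) y≤ i<y s≤top top≤t) (cong (place y ∸_) (place-down 1≤i i≤n di))
    where s≤top = ≤-trans (proj₂ (place-down-range 1≤i i≤n di)) (n≤1+n a)

  μ-up-below : ∀ {i y} → 1 ≤ i → i ≤ n → up i ≡ true → y < i → place y ≤ a →
    μ i y ≡ place y + #up i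
  μ-up-below {i} {y} 1≤i i≤n ui y<i t≤a = begin
    μ i y
      ≡⟨ μ-downward i≤ (<⇒≤ (<-≤-trans y<i i≤)) y<i (≤-trans t≤a (n≤1+n a)) (<⇒≤ top<s)
                    (≤-<-trans t≤a (<-trans (n<1+n a) top<s)) ⟩
    place y + (N ∸ place i)
      ≡⟨ cong (λ s → place y + (N ∸ s)) (place-up 1≤i i≤n ui) ⟩
    place y + (N ∸ upPos (#up i))
      ≡⟨ cong (place y +_) (N∸upPos (proj₂ (#up-range 1≤i i≤n ui))) ⟩
    place y + #up i ∎
    where
    open ≡-Reasoning
    i≤ = m≤n⇒m≤1+n i≤n
    top<s = a<place-up 1≤i i≤n ui

  #down-pos : ∀ {K} → 1 ≤ K → 1 ≤ #down K
  #down-pos 1≤K = D.count-mono 1≤K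

  cut-injective : ∀ {K K′} → #down K ≡ #down K′ → #up K ≡ #up K′ → K ≡ K′
  cut-injective {K} {K′} d≡ u≡ =
    trans (sym (#down+#up K)) (trans (cong₂ _+_ d≡ u≡) (#down+#up K′))

  #up≤b : ∀ {K} → K ≤ n → #up K ≤ b
  #up≤b = U.count-mono

  1≤suc-n∸ : ∀ {i} → i ≤ n → 1 ≤ suc n ∸ i
  1≤suc-n∸ i≤n = m<n⇒0<n∸m (s≤s i≤n)

  down-successor : ∀ {i} → 1 ≤ i → i ≤ n → down i ≡ true →
    Σ ℕ λ y → i < y × y ≤ suc n × suc (place i) % N ≡ place y
  down-successor {i} 1≤i i≤n di with m≤n⇒m<n∨m≡n (proj₂ (#down-range 1≤i i≤n di))
  ... | inj₂ s≡a = suc n , s≤s i≤n , ≤-refl ,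
    trans (cong (λ z → suc z % N) (trans (place-down 1≤i i≤n di) s≡a))
          (trans (m<n⇒m%n≡m a<N) (sym place-top))
  ... | inj₁ s<a with label-lower (s≤s z≤n) s<a
  ...   | y , 1≤y , y≤n , dy , cy , _ = y , D.count-<⇒< (≤-reflexive (sym cy)) , m≤n⇒m≤1+n y≤n ,
    trans (cong (λ z → suc z % N) (place-down 1≤i i≤n di))
          (trans (m<n⇒m%n≡m (<-trans (s≤s s<a) a<N)) (sym (trans (place-down 1≤y y≤n dy) cy)))

  down-predecessor : ∀ {i} → 1 ≤ i → i ≤ n → down i ≡ true →
    Σ ℕ λ x → x < i × suc (place x) % N ≡ place i
  down-predecessor {i} 1≤i i≤n di with #down i in ci | #down-range 1≤i i≤n di
  ... | suc zero    | _ = 0 , 1≤i , sym (trans (place-down 1≤i i≤n di) ci)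
  ... | suc (suc c) | _ , s≤a with label-lower (s≤s z≤n) (≤-trans (n≤1+n _) s≤a)
  ...   | x , 1≤x , x≤n , dx , cx , _ =
    x , D.count-<⇒< (subst (#down x <_) (sym ci) (≤-reflexive (cong suc cx))) ,
    trans (cong (λ z → suc z % N) (trans (place-down 1≤x x≤n dx) cx))
          (trans (m<n⇒m%n≡m (<-trans (s≤s s≤a) a<N)) (sym (trans (place-down 1≤i i≤n di) ci)))

  up-successor : ∀ {i} → 1 ≤ i → i ≤ n → up i ≡ true →
    Σ ℕ λ x → x < i × suc (place i) % N ≡ place x
  up-successor {i} 1≤i i≤n ui with #up i in ci | #up-range 1≤i i≤n ui
  ... | suc zero    | _ , c≤b = 0 , 1≤i ,
    trans (cong (λ z → suc z % N) (trans (place-up 1≤i i≤n ui) (cong upPos ci)))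
          (trans (cong (_% N) (trans (+-comm 1 (upPos 1)) (upPos+c c≤b))) (n%n≡0 N))
  ... | suc (suc c) | _ , c≤b with label-upper (s≤s z≤n) (≤-trans (n≤1+n _) c≤b)
  ...   | x , 1≤x , x≤n , ux , cx , _ =
    x , U.count-<⇒< (subst (#up x <_) (sym ci) (≤-reflexive (cong suc cx))) ,
    trans (cong (λ z → suc z % N) (trans (place-up 1≤i i≤n ui) (cong upPos ci)))
          (trans (cong (_% N) (suc-upPos c≤b))
                 (trans (m<n⇒m%n≡m (upPos<N (s≤s z≤n) (≤-trans (n≤1+n _) c≤b)))
                        (sym (trans (place-up 1≤x x≤n ux) (cong upPos cx)))))

  up-predecessor : ∀ {i} → 1 ≤ i → i ≤ n → up i ≡ true →
    Σ ℕ λ y → i < y × y ≤ suc n × suc (place y) % N ≡ place i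
  up-predecessor {i} 1≤i i≤n ui =
    proj₁ above , proj₁ (proj₂ above) , proj₁ (proj₂ (proj₂ above)) ,
    trans (cong (_% N) (proj₂ (proj₂ (proj₂ above)))) (m<n⇒m%n≡m (place<N (m≤n⇒m≤1+n i≤n)))
    where
    above : Σ ℕ λ y → i < y × y ≤ suc n × suc (place y) ≡ place i
    above with m≤n⇒m<n∨m≡n (proj₂ (#up-range 1≤i i≤n ui))
    ... | inj₂ c≡b = suc n , s≤s i≤n , ≤-refl ,
      trans (cong suc place-top)
            (sym (trans (place-up 1≤i i≤n ui)
                        (trans (cong upPos c≡b)
                               (cong (suc ∘ suc) (trans (cong (a +_) (n∸n≡0 b)) (+-identityʳ a))))))
    ... | inj₁ c<b with label-upper (s≤s z≤n) c<b
    ...   | y , 1≤y , y≤n , uy , cy , _ = y , U.count-<⇒< (≤-reflexive (sym cy)) , m≤n⇒m≤1+n y≤n ,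
      trans (cong suc (trans (place-up 1≤y y≤n uy) (cong upPos cy)))
            (trans (suc-upPos c<b) (sym (place-up 1≤i i≤n ui)))

  right-boundary-down : ∀ D {i} → 1 ≤ i → i ≤ n → down i ≡ true → RightWitness D i 1
  right-boundary-down D {i} 1≤i i≤n di with down-successor 1≤i i≤n di
  ... | y , i<y , y≤ , next =
    y , i<y , y≤ , adjPos-next D (place i) (place y) next , μ-next (m≤n⇒m≤1+n i≤n) y≤ next

  left-boundary-up : ∀ D {i} → 1 ≤ i → i ≤ n → up i ≡ true → LeftWitness D i 1
  left-boundary-up D {i} 1≤i i≤n ui with up-successor 1≤i i≤n ui
  ... | x , x<i , next =
    x , x<i , adjPos-prev D (place x) (place i) next , μ-next i≤ (≤-trans (<⇒≤ x<i) i≤) next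
    where i≤ = m≤n⇒m≤1+n i≤n

  left-boundary-down : ∀ D {i} → 1 ≤ i → i ≤ n → down i ≡ true → LeftWitness D i 1
  left-boundary-down D {i} 1≤i i≤n di with down-predecessor 1≤i i≤n di
  ... | x , x<i , prev =
    x , x<i , adjPos-next D (place x) (place i) prev ,
    μ-prev 1≤i i≤n (≤-trans (<⇒≤ x<i) (m≤n⇒m≤1+n i≤n)) prev

  right-boundary-up : ∀ D {i} → 1 ≤ i → i ≤ n → up i ≡ true → RightWitness D i 1
  right-boundary-up D {i} 1≤i i≤n ui with up-predecessor 1≤i i≤n ui
  ... | y , i<y , y≤ , prev =
    y , i<y , y≤ , adjPos-prev D (place i) (place y) prev , μ-prev 1≤i i≤n y≤ prev

  xcoord-up : ∀ D i {l r} → up i ≡ true → pl n o D i ≡ l → pr n o D i ≡ r →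
    xcoord n o D i ≡ suc n ∸ l * r
  xcoord-up D i e refl refl rewrite e = refl

  xcoord-down : ∀ D i {l r} → up i ≡ false → pl n o D i ≡ l → pr n o D i ≡ r →
    xcoord n o D i ≡ l * r
  xcoord-down D i e refl refl rewrite e = refl

  module Ascending where

    -- The largest up label ≤ K sits at place upPos (#up K), or it is 0 when
    -- #up K = 0; the smallest down label > K sits at #down K + 1 since n is down.
    join : ℕ → ℕ → ℕ × ℕ
    join zero    l = 0 , suc l
    join (suc c) l = suc l , upPos (suc c)

    diagonal : ℕ → ℕ × ℕ
    diagonal K = join (#up K) (#down K)

    diagonals : List (ℕ × ℕ)
    diagonals = cuts diagonal

    data Shape (c l : ℕ) : Set where
      from-bottom : c ≡ 0 → join c l ≡ (0 , suc l) → Shape c l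
      from-up     : 1 ≤ c → join c l ≡ (suc l , upPos c) → Shape c l

    shape : ∀ c l → Shape c l
    shape zero    l = from-bottom refl refl
    shape (suc c) l = from-up (s≤s z≤n) refl

    isDiagonal : ∀ {K} → 1 ≤ K → K < n → IsDiagonal n (diagonal K)
    isDiagonal {K} 1≤K K<n with shape (#up K) (#down K)
    ... | from-bottom _ eq rewrite eq = s≤s (#down-pos 1≤K) , l<n , s≤s (m≤n⇒m≤1+n l<n)
      where l<n = ≤-trans (#down<a K<n) a≤n
    ... | from-up 1≤c eq rewrite eq =
      s≤s (s≤s (≤-trans (#down<a K<n) (m≤m+n a _))) ,
      ≤-trans (∸-monoʳ-≤ (upPos (#up K)) (s≤s (z≤n {#down K})))
              (subst (suc (a + (b ∸ #up K)) ≤_) a+b≡n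
                     (+-monoʳ-< a (∸-monoʳ-< 1≤c (#up≤b (<⇒≤ K<n))))) ,
      upPos<N 1≤c (#up≤b (<⇒≤ K<n))

    compatible : ∀ {K K′} → K < K′ → K′ < n →
      diagonal K ≢ diagonal K′ × ¬ Cross (diagonal K) (diagonal K′)
    compatible {K} {K′} K<K′ K′<n with shape (#up K) (#down K) | shape (#up K′) (#down K′)
    ... | from-bottom u≡0 eq | from-bottom u′≡0 eq′ rewrite eq | eq′ =
      (λ d≡ → <-irrefl (cut-injective (suc-injective (cong proj₂ d≡)) (trans u≡0 (sym u′≡0))) K<K′) ,
      ¬Cross-same-start
    ... | from-bottom _ eq | from-up _ eq′ rewrite eq | eq′ =
      (λ ()) , ¬Cross-from-zero (s≤s (D.count-mono K≤K′))
      where K≤K′ = <⇒≤ K<K′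
    ... | from-up 1≤u _ | from-bottom u′≡0 _ =
      ⊥-elim (<⇒≱ 1≤u (subst (#up K ≤_) u′≡0 (U.count-mono (<⇒≤ K<K′))))
    ... | from-up _ eq | from-up _ eq′ rewrite eq | eq′ =
      (λ d≡ → <-irrefl (cut-injective (suc-injective (cong proj₁ d≡))
                                      (upPos-injective u≤b u′≤b (cong proj₂ d≡))) K<K′) ,
      ¬Cross-nested (s≤s (D.count-mono (<⇒≤ K<K′))) (upPos-antitone (U.count-mono (<⇒≤ K<K′)))
      where
      u≤b = #up≤b (<⇒≤ (<-trans K<K′ K′<n))
      u′≤b = #up≤b (<⇒≤ K′<n)

    isTriangulation : IsTriangulation n diagonals
    isTriangulation = cuts-isTriangulation diagonal isDiagonal compatible

    joined-down : ∀ {i x} → 1 ≤ i → i ≤ n → down i ≡ true → x ≤ suc n → Joined diagonals x i →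
      x < i × μ i x ≤ i
    joined-down {i} {x} 1≤i i≤n di x≤ joined with ∈cuts diagonal joined
    ... | K , 1≤K , K<n , on with shape (#up K) (#down K) | on
    ... | from-bottom _ eq | inj₁ q with placed-bottom x≤ (sym (cong proj₁ (trans (sym eq) q)))
    ...   | refl = 1≤i , ≤-trans (≤-reflexive (μ-down-bottom 1≤i i≤n di)) (D.count-≤ i)
    joined-down 1≤i i≤n di x≤ joined | K , _ , _ , _ | from-bottom _ eq | inj₂ q =
      ⊥-elim (<⇒≱ (proj₁ (place-down-range 1≤i i≤n di))
                  (≤-reflexive (sym (cong proj₁ (trans (sym eq) q)))))
    joined-down 1≤i i≤n di x≤ joined | K , _ , _ , _ | from-up _ eq | inj₁ q =
      ⊥-elim (<⇒≱ (<-trans (s≤s (proj₂ (place-down-range 1≤i i≤n di))) (a<upPos (#up K)))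
                  (≤-reflexive (cong proj₂ (trans (sym eq) q))))
    joined-down {i} {x} 1≤i i≤n di x≤ joined | K , _ , K<n , _ | from-up 1≤c eq | inj₂ q =
      x<i , ≤-trans (≤-reflexive (trans (μ-down-up 1≤i i≤n di 1≤x x≤n ux x<i)
                                        (trans (cong₂ _+_ #down-i cx) (cong suc (#down+#up K))))) K<i
      where
      x-is-up = placed-upper x≤ (sym (cong proj₂ (trans (sym eq) q))) 1≤c (#up≤b (<⇒≤ K<n))
      1≤x = proj₁ x-is-up
      x≤n = proj₁ (proj₂ x-is-up)
      ux = proj₁ (proj₂ (proj₂ x-is-up))
      cx = proj₂ (proj₂ (proj₂ x-is-up))
      #down-i : #down i ≡ suc (#down K)
      #down-i = trans (sym (place-down 1≤i i≤n di)) (sym (cong proj₁ (trans (sym eq) q)))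
      K<i : K < i
      K<i = D.count-<⇒< (≤-reflexive (sym #down-i))
      x<i : x < i
      x<i = ≤-<-trans (U.count-≤⇒≤ ux (≤-reflexive cx)) K<i

    joined-up : ∀ {i x} → 1 ≤ i → i ≤ n → up i ≡ true → x ≤ suc n → Joined diagonals x i →
      i < x × μ i x ≤ suc n ∸ i
    joined-up {i} {x} 1≤i i≤n ui x≤ joined with ∈cuts diagonal joined
    ... | K , 1≤K , K<n , on with shape (#up K) (#down K) | on
    ... | from-bottom _ eq | inj₁ q = ⊥-elim (<⇒≱ (a<place-up 1≤i i≤n ui)
            (≤-trans (≤-reflexive (sym (cong proj₂ (trans (sym eq) q))))
                     (≤-trans (#down<a K<n) (n≤1+n a))))
    ... | from-bottom _ eq | inj₂ q = ⊥-elim (<⇒≱ (<-trans (s≤s z≤n) (a<place-up 1≤i i≤n ui))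
            (≤-reflexive (sym (cong proj₁ (trans (sym eq) q)))))
    ... | from-up _ eq | inj₂ q = ⊥-elim (<⇒≱ (a<place-up 1≤i i≤n ui)
            (≤-trans (≤-reflexive (sym (cong proj₁ (trans (sym eq) q))))
                     (≤-trans (#down<a K<n) (n≤1+n a))))
    ... | from-up _ eq | inj₁ q =
      i<x , ≤-trans (≤-reflexive (trans (μ-up-down 1≤i i≤n ui 1≤x x≤n dx i<x)
                                        (cong (N ∸_) (trans (cong₂ _+_ cx #up-i) (cong suc (#down+#up K))))))
                    (∸-monoʳ-≤ (suc n) i≤K)
      where
      x-is-down = placed-lower x≤ (sym (cong proj₁ (trans (sym eq) q))) (s≤s z≤n) (#down<a K<n)
      1≤x = proj₁ x-is-down
      x≤n = proj₁ (proj₂ x-is-down)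
      dx = proj₁ (proj₂ (proj₂ x-is-down))
      cx = proj₂ (proj₂ (proj₂ x-is-down))
      #up-i : #up i ≡ #up K
      #up-i = upPos-injective (proj₂ (#up-range 1≤i i≤n ui)) (#up≤b (<⇒≤ K<n))
                (trans (sym (place-up 1≤i i≤n ui)) (sym (cong proj₂ (trans (sym eq) q))))
      i≤K : i ≤ K
      i≤K = U.count-≤⇒≤ ui (≤-reflexive #up-i)
      i<x : i < x
      i<x = ≤-<-trans i≤K (D.count-<⇒< (≤-reflexive (sym cx)))

    left-witness-down : ∀ {i} → 1 ≤ i → i ≤ n → down i ≡ true → LeftWitness diagonals i i
    left-witness-down {suc zero} 1≤i i≤n di =
      0 , s≤s z≤n , adjPos-next diagonals (place 0) (place 1) (sym (place-down 1≤i i≤n di)) ,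
      μ-down-bottom 1≤i i≤n di
    left-witness-down {suc (suc k)} 1≤i i≤n di with shape (#up (suc k)) (#down (suc k))
    ... | from-bottom u≡0 eq =
      0 , s≤s z≤n ,
      cut-adjacent diagonal (s≤s z≤n) i≤n (inj₁ (trans eq (cong (0 ,_) (sym place-i)))) ,
      (begin
        μ i 0             ≡⟨ μ-down-bottom 1≤i i≤n di ⟩
        #down i           ≡⟨ +-identityʳ (#down i) ⟨
        #down i + 0       ≡⟨ cong (#down i +_) (trans #up-i u≡0) ⟨
        #down i + #up i   ≡⟨ #down+#up i ⟩
        i                 ∎)
      where
      open ≡-Reasoning
      i = suc (suc k)
      place-i : place i ≡ suc (#down (suc k))
      place-i = trans (place-down 1≤i i≤n di) (D.count-suc-true (suc k) di)
      #up-i : #up i ≡ #up (suc k)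
      #up-i = U.count-suc-false (suc k) (down⇒not-up i di)
    ... | from-up 1≤c eq with label-upper 1≤c (#up≤b (<⇒≤ i≤n))
    ...   | x , 1≤x , x≤n , ux , cx , _ =
      x , x<i ,
      cut-adjacent diagonal (s≤s z≤n) i≤n (inj₂ (trans eq (cong₂ _,_ (sym place-i) (sym place-x)))) ,
      (begin
        μ i x             ≡⟨ μ-down-up 1≤i i≤n di 1≤x x≤n ux x<i ⟩
        #down i + #up x   ≡⟨ cong (#down i +_) (trans cx (sym #up-i)) ⟩
        #down i + #up i   ≡⟨ #down+#up i ⟩
        i                 ∎)
      where
      open ≡-Reasoning
      i = suc (suc k)
      place-i : place i ≡ suc (#down (suc k))
      place-i = trans (place-down 1≤i i≤n di) (D.count-suc-true (suc k) di)
      #up-i : #up i ≡ #up (suc k)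
      #up-i = U.count-suc-false (suc k) (down⇒not-up i di)
      place-x : place x ≡ upPos (#up (suc k))
      place-x = trans (place-up 1≤x x≤n ux) (cong upPos cx)
      x<i : x < i
      x<i = s≤s (U.count-≤⇒≤ ux (≤-reflexive cx))

    right-witness-up : ∀ {i} → 1 ≤ i → i ≤ n → up i ≡ true → RightWitness diagonals i (suc n ∸ i)
    right-witness-up {i} 1≤i i≤n ui
      with shape (#up i) (#down i) | label-lower (s≤s z≤n) (#down<a (up⇒<n i≤n ui))
    ... | from-bottom u≡0 _ | _ = ⊥-elim (<⇒≱ (proj₁ (#up-range 1≤i i≤n ui)) (≤-reflexive u≡0))
    ... | from-up _ eq | y , 1≤y , y≤n , dy , cy , _ =
      y , i<y , m≤n⇒m≤1+n y≤n ,
      cut-adjacent diagonal 1≤i (up⇒<n i≤n ui)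
        (inj₂ (trans eq (cong₂ _,_ (sym place-y) (sym (place-up 1≤i i≤n ui))))) ,
      trans (μ-up-down 1≤i i≤n ui 1≤y y≤n dy i<y)
            (cong (N ∸_) (trans (cong (_+ #up i) cy) (cong suc (#down+#up i))))
      where
      place-y : place y ≡ suc (#down i)
      place-y = trans (place-down 1≤y y≤n dy) cy
      i<y : i < y
      i<y = D.count-<⇒< (≤-reflexive (sym cy))

    pl-down : ∀ {i} → 1 ≤ i → i ≤ n → down i ≡ true → pl n o diagonals i ≡ i
    pl-down 1≤i i≤n di = pl≡ diagonals 1≤i i≤n 1≤i
      (λ x≤ _ joined → proj₂ (joined-down 1≤i i≤n di x≤ joined)) (left-witness-down 1≤i i≤n di)

    pr-down : ∀ {i} → 1 ≤ i → i ≤ n → down i ≡ true → pr n o diagonals i ≡ 1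
    pr-down 1≤i i≤n di = pr≡ diagonals 1≤i i≤n ≤-refl
      (λ y≤ i<y joined → ⊥-elim (<-asym i<y (proj₁ (joined-down 1≤i i≤n di y≤ joined))))
      (right-boundary-down diagonals 1≤i i≤n di)

    pl-up : ∀ {i} → 1 ≤ i → i ≤ n → up i ≡ true → pl n o diagonals i ≡ 1
    pl-up 1≤i i≤n ui = pl≡ diagonals 1≤i i≤n ≤-refl
      (λ x≤ x<i joined → ⊥-elim (<-asym x<i (proj₁ (joined-up 1≤i i≤n ui x≤ joined))))
      (left-boundary-up diagonals 1≤i i≤n ui)

    pr-up : ∀ {i} → 1 ≤ i → i ≤ n → up i ≡ true → pr n o diagonals i ≡ suc n ∸ i
    pr-up 1≤i i≤n ui = pr≡ diagonals 1≤i i≤n (1≤suc-n∸ i≤n)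
      (λ y≤ _ joined → proj₂ (joined-up 1≤i i≤n ui y≤ joined)) (right-witness-up 1≤i i≤n ui)

    xcoord≡ : ∀ {i} → 1 ≤ i → i ≤ n → xcoord n o diagonals i ≡ i
    xcoord≡ {i} 1≤i i≤n with bool-cases (up i)
    ... | inj₁ ui = trans (xcoord-up diagonals i ui (pl-up 1≤i i≤n ui) (pr-up 1≤i i≤n ui))
                          (trans (cong (suc n ∸_) (*-identityˡ (suc n ∸ i))) (m∸[m∸n]≡n (m≤n⇒m≤1+n i≤n)))
    ... | inj₂ ¬ui = trans (xcoord-down diagonals i ¬ui (pl-down 1≤i i≤n di) (pr-down 1≤i i≤n di))
                           (*-identityʳ i)
      where di = not-up⇒down i ¬ui

  module Descending where

    -- The largest down label ≤ K (or 0) sits at place #down K; the smallest up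
    -- label > K (or n+1 if there is none) sits at a + (b ∸ #up K) + 1.
    far : ℕ → ℕ
    far K = suc (a + (b ∸ #up K))

    diagonal : ℕ → ℕ × ℕ
    diagonal K = #down K , far K

    diagonals : List (ℕ × ℕ)
    diagonals = cuts diagonal

    far≤n : ∀ K → a + (b ∸ #up K) ≤ n
    far≤n K = subst (a + (b ∸ #up K) ≤_) a+b≡n (+-monoʳ-≤ a (m∸n≤m b (#up K)))

    far∸#down : ∀ {K} → K ≤ n → far K ∸ #down K ≡ suc n ∸ K
    far∸#down {K} K≤n = begin
      suc (a + (b ∸ #up K)) ∸ #down K  ≡⟨ cong (λ z → suc z ∸ #down K) (sym (+-∸-assoc a u≤b)) ⟩
      suc (a + b ∸ #up K) ∸ #down K    ≡⟨ cong (λ z → suc (z ∸ #up K) ∸ #down K) a+b≡n ⟩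
      suc (n ∸ #up K) ∸ #down K        ≡⟨ cong (_∸ #down K) (sym (+-∸-assoc 1 u≤n)) ⟩
      suc n ∸ #up K ∸ #down K          ≡⟨ ∸-+-assoc (suc n) (#up K) (#down K) ⟩
      suc n ∸ (#up K + #down K)        ≡⟨ cong (suc n ∸_) (trans (+-comm (#up K) (#down K)) (#down+#up K)) ⟩
      suc n ∸ K                        ∎
      where
      open ≡-Reasoning
      u≤b = #up≤b K≤n
      u≤n : #up K ≤ n
      u≤n = ≤-trans u≤b (subst (b ≤_) a+b≡n (m≤n+m b a))

    isDiagonal : ∀ {K} → 1 ≤ K → K < n → IsDiagonal n (diagonal K)
    isDiagonal {K} 1≤K K<n =
      s≤s (≤-trans (#down<a K<n) (m≤m+n a _)) ,
      ≤-trans (∸-monoʳ-≤ (far K) (#down-pos 1≤K)) (far≤n K) ,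
      s≤s (s≤s (far≤n K))

    compatible : ∀ {K K′} → K < K′ → K′ < n →
      diagonal K ≢ diagonal K′ × ¬ Cross (diagonal K) (diagonal K′)
    compatible {K} {K′} K<K′ K′<n =
      (λ d≡ → <-irrefl (cut-injective (cong proj₁ d≡)
                 (∸-cancelˡ-≡ u≤b u′≤b (+-cancelˡ-≡ a _ _ (suc-injective (cong proj₂ d≡))))) K<K′) ,
      ¬Cross-nested (D.count-mono (<⇒≤ K<K′)) (s≤s (+-monoʳ-≤ a (∸-monoʳ-≤ b (U.count-mono (<⇒≤ K<K′)))))
      where
      u≤b = #up≤b (<⇒≤ (<-trans K<K′ K′<n))
      u′≤b = #up≤b (<⇒≤ K′<n)

    isTriangulation : IsTriangulation n diagonals
    isTriangulation = cuts-isTriangulation diagonal isDiagonal compatible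

    a<far : ∀ K → suc a ≤ far K
    a<far K = s≤s (m≤m+n a _)

    far-cases : ∀ {K} → K ≤ n →
      (#up K ≡ b × far K ≡ suc a) ⊎ (#up K < b × far K ≡ upPos (suc (#up K)))
    far-cases {K} K≤n with m≤n⇒m<n∨m≡n (#up≤b K≤n)
    ... | inj₂ u≡b = inj₁ (u≡b , cong suc (trans (cong (λ c → a + (b ∸ c)) u≡b)
                                                 (trans (cong (a +_) (n∸n≡0 b)) (+-identityʳ a))))
    ... | inj₁ u<b = inj₂ (u<b , suc-injective (sym (suc-upPos u<b)))

    far-end : ∀ {K} → K ≤ n → Σ ℕ λ y → y ≤ suc n × place y ≡ far K × K < y
    far-end {K} K≤n with far-cases K≤n
    ... | inj₁ (_ , far≡) = suc n , ≤-refl , trans place-top (sym far≡) , s≤s K≤n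
    ... | inj₂ (u<b , far≡) with label-upper (s≤s z≤n) u<b
    ...   | y , 1≤y , y≤n , uy , cy , _ =
      y , m≤n⇒m≤1+n y≤n , trans (place-up 1≤y y≤n uy) (trans (cong upPos cy) (sym far≡)) ,
      U.count-<⇒< (≤-reflexive (sym cy))

    placed-far : ∀ {K x} → K ≤ n → x ≤ suc n → place x ≡ far K → K < x
    placed-far {K} K≤n x≤ px with far-cases K≤n
    ... | inj₁ (_ , far≡) with placed-top x≤ (trans px far≡)
    ...   | refl = s≤s K≤n
    placed-far {K} K≤n x≤ px | inj₂ (u<b , far≡)
      with placed-upper x≤ (trans px far≡) (s≤s z≤n) u<b
    ...   | _ , _ , _ , cx = U.count-<⇒< (≤-reflexive (sym cx))

    joined-down : ∀ {i x} → 1 ≤ i → i ≤ n → down i ≡ true → x ≤ suc n → Joined diagonals x i →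
      i < x × μ i x ≤ suc n ∸ i
    joined-down {i} {x} 1≤i i≤n di x≤ joined with ∈cuts diagonal joined
    ... | K , _ , K<n , inj₁ q =
      ⊥-elim (<⇒≱ (≤-trans (s≤s (proj₂ (place-down-range 1≤i i≤n di))) (a<far K))
                  (≤-reflexive (cong proj₂ q)))
    ... | K , _ , K<n , inj₂ q = i<x , ≤-trans (≤-reflexive μ≡) (∸-monoʳ-≤ (suc n) i≤K)
      where
      #down-i : #down i ≡ #down K
      #down-i = trans (sym (place-down 1≤i i≤n di)) (sym (cong proj₁ q))
      i≤K : i ≤ K
      i≤K = D.count-≤⇒≤ di (≤-reflexive #down-i)
      i<x : i < x
      i<x = ≤-<-trans i≤K (placed-far (<⇒≤ K<n) x≤ (sym (cong proj₂ q)))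
      μ≡ : μ i x ≡ suc n ∸ K
      μ≡ = trans (μ-down-above 1≤i i≤n di x≤ i<x (subst (suc a ≤_) (cong proj₂ q) (a<far K)))
                 (trans (cong₂ _∸_ (sym (cong proj₂ q)) #down-i) (far∸#down (<⇒≤ K<n)))

    joined-up : ∀ {i x} → 1 ≤ i → i ≤ n → up i ≡ true → x ≤ suc n → Joined diagonals x i →
      x < i × μ i x ≤ i
    joined-up {i} {x} 1≤i i≤n ui x≤ joined with ∈cuts diagonal joined
    ... | K , _ , K<n , inj₂ q = ⊥-elim (<⇒≱ (a<place-up 1≤i i≤n ui)
            (≤-trans (≤-reflexive (sym (cong proj₁ q))) (≤-trans (D.count-mono (<⇒≤ K<n)) (n≤1+n a))))
    ... | K , 1≤K , K<n , inj₁ q with far-cases (<⇒≤ K<n)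
    ...   | inj₁ (_ , far≡) = ⊥-elim (<⇒≢ (a<place-up 1≤i i≤n ui) (trans (sym far≡) (cong proj₂ q)))
    ...   | inj₂ (u<b , far≡) = x<i , ≤-trans (≤-reflexive μ≡) K<i
      where
      x-is-down = placed-lower x≤ (sym (cong proj₁ q)) (#down-pos 1≤K) (D.count-mono (<⇒≤ K<n))
      dx = proj₁ (proj₂ (proj₂ x-is-down))
      cx = proj₂ (proj₂ (proj₂ x-is-down))
      #up-i : #up i ≡ suc (#up K)
      #up-i = upPos-injective (proj₂ (#up-range 1≤i i≤n ui)) u<b
                (trans (sym (place-up 1≤i i≤n ui)) (trans (sym (cong proj₂ q)) far≡))
      K<i : K < i
      K<i = U.count-<⇒< (≤-reflexive (sym #up-i))
      x<i : x < i
      x<i = ≤-<-trans (D.count-≤⇒≤ dx (≤-reflexive cx)) K<i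
      K≤n = <⇒≤ K<n
      μ≡ : μ i x ≡ suc K
      μ≡ = begin
        μ i x                  ≡⟨ μ-up-below 1≤i i≤n ui x<i (subst (_≤ a) (cong proj₁ q) (D.count-mono K≤n)) ⟩
        place x + #up i        ≡⟨ cong₂ _+_ (sym (cong proj₁ q)) #up-i ⟩
        #down K + suc (#up K)  ≡⟨ +-suc (#down K) (#up K) ⟩
        suc (#down K + #up K)  ≡⟨ cong suc (#down+#up K) ⟩
        suc K                  ∎
        where open ≡-Reasoning

    right-witness-down : ∀ {i} → 1 ≤ i → i ≤ n → down i ≡ true → RightWitness diagonals i (suc n ∸ i)
    right-witness-down {i} 1≤i i≤n di with m≤n⇒m<n∨m≡n i≤n
    ... | inj₂ refl =
      subst (RightWitness diagonals i) (sym (m+n∸n≡m 1 i)) (right-boundary-down diagonals 1≤i i≤n di)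
    ... | inj₁ i<n with far-end (<⇒≤ i<n)
    ...   | y , y≤ , place-y , i<y =
      y , i<y , y≤ ,
      cut-adjacent diagonal 1≤i i<n (inj₁ (cong₂ _,_ (sym (place-down 1≤i i≤n di)) (sym place-y))) ,
      trans (μ-down-above 1≤i i≤n di y≤ i<y (subst (suc a ≤_) (sym place-y) (a<far i)))
            (trans (cong (_∸ #down i) place-y) (far∸#down i≤n))

    left-witness-up : ∀ {i} → 1 ≤ i → i ≤ n → up i ≡ true → LeftWitness diagonals i i
    left-witness-up {suc zero}    _   _   ()
    left-witness-up {suc (suc k)} 1≤i i≤n ui
      with label-lower (#down-pos (s≤s (z≤n {k}))) (D.count-mono (≤-trans (n≤1+n (suc k)) i≤n))
    ... | x , 1≤x , x≤n , dx , cx , _ =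
      x , x<i ,
      cut-adjacent diagonal (s≤s z≤n) i≤n (inj₁ (cong₂ _,_ (sym place-x) far≡place-i)) ,
      (begin
        μ i x                  ≡⟨ μ-up-below 1≤i i≤n ui x<i (subst (_≤ a) (sym place-x) (D.count-mono K≤n)) ⟩
        place x + #up i        ≡⟨ cong₂ _+_ place-x #up-i ⟩
        #down K + suc (#up K)  ≡⟨ +-suc (#down K) (#up K) ⟩
        suc (#down K + #up K)  ≡⟨ cong suc (#down+#up K) ⟩
        i                      ∎)
      where
      open ≡-Reasoning
      i = suc (suc k)
      K = suc k
      K≤n = ≤-trans (n≤1+n K) i≤n
      place-x : place x ≡ #down K
      place-x = trans (place-down 1≤x x≤n dx) cx
      #up-i : #up i ≡ suc (#up K)
      #up-i = U.count-suc-true K ui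
      x<i : x < i
      x<i = s≤s (D.count-≤⇒≤ dx (≤-reflexive cx))
      far≡place-i : far K ≡ place i
      far≡place-i with far-cases K≤n
      ... | inj₁ (u≡b , _) =
        ⊥-elim (<-irrefl refl (subst (_≤ b) (trans #up-i (cong suc u≡b)) (proj₂ (#up-range 1≤i i≤n ui))))
      ... | inj₂ (_ , far≡) = trans far≡ (sym (trans (place-up 1≤i i≤n ui) (cong upPos #up-i)))

    pl-down : ∀ {i} → 1 ≤ i → i ≤ n → down i ≡ true → pl n o diagonals i ≡ 1
    pl-down 1≤i i≤n di = pl≡ diagonals 1≤i i≤n ≤-refl
      (λ x≤ x<i joined → ⊥-elim (<-asym x<i (proj₁ (joined-down 1≤i i≤n di x≤ joined))))
      (left-boundary-down diagonals 1≤i i≤n di)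

    pr-down : ∀ {i} → 1 ≤ i → i ≤ n → down i ≡ true → pr n o diagonals i ≡ suc n ∸ i
    pr-down 1≤i i≤n di = pr≡ diagonals 1≤i i≤n (1≤suc-n∸ i≤n)
      (λ y≤ _ joined → proj₂ (joined-down 1≤i i≤n di y≤ joined)) (right-witness-down 1≤i i≤n di)

    pl-up : ∀ {i} → 1 ≤ i → i ≤ n → up i ≡ true → pl n o diagonals i ≡ i
    pl-up 1≤i i≤n ui = pl≡ diagonals 1≤i i≤n 1≤i
      (λ x≤ _ joined → proj₂ (joined-up 1≤i i≤n ui x≤ joined)) (left-witness-up 1≤i i≤n ui)

    pr-up : ∀ {i} → 1 ≤ i → i ≤ n → up i ≡ true → pr n o diagonals i ≡ 1
    pr-up 1≤i i≤n ui = pr≡ diagonals 1≤i i≤n ≤-refl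
      (λ y≤ i<y joined → ⊥-elim (<-asym i<y (proj₁ (joined-up 1≤i i≤n ui y≤ joined))))
      (right-boundary-up diagonals 1≤i i≤n ui)

    xcoord≡ : ∀ {i} → 1 ≤ i → i ≤ n → xcoord n o diagonals i ≡ suc n ∸ i
    xcoord≡ {i} 1≤i i≤n with bool-cases (up i)
    ... | inj₁ ui = trans (xcoord-up diagonals i ui (pl-up 1≤i i≤n ui) (pr-up 1≤i i≤n ui))
                          (cong (suc n ∸_) (*-identityʳ i))
    ... | inj₂ ¬ui = trans (xcoord-down diagonals i ¬ui (pl-down 1≤i i≤n di) (pr-down 1≤i i≤n di))
                           (*-identityˡ (suc n ∸ i))
      where di = not-up⇒down i ¬ui

corollary2p3 : (n : ℕ) → 2 ≤ n → (o : Orientation n) →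
    Σ (Triangulation n) (λ T → Σ (Triangulation n) (λ T' →
      (M n o T ≡ range1 n) × (M n o T' ≡ reverse (range1 n))))
corollary2p3 n 2≤n o =
  (Ascending.diagonals , Ascending.isTriangulation) ,
  (Descending.diagonals , Descending.isTriangulation) ,
  trans (map-range1-cong Ascending.xcoord≡) (map-id (range1 n)) ,
  trans (map-range1-cong Descending.xcoord≡) (sym (reverse-range1 n))
  where open Polygon n 2≤n o
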